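{- Let $k\ge 2$ and let $A=\{a_1,\dots,a_k\}$ be positive integers with $\gcd(a_1,\dots,a_k)=1$. For $1\le i\le a_1-1$ let $m_i$ be the least positive integer with $m_i\equiv i\pmod{a_1}$ and $m_i\in{\rm R}(A)$. Then for every positive integer $\mu$, $$ \sum_{n\in{\rm NR}(A)}n^\mu=\sum_{\kappa=0}^\mu\sum_{j=1}^{\kappa+1}\binom{\mu}{\kappa}\binom{\kappa+1}{j}\frac{(-1)^{j-1}}{\kappa+1}a_1^{\kappa-j}B_{\kappa-j+1}\sum_{i=1}^{a_1-1}(m_i-i)^j m_i^{\mu-\kappa}. $$
   Context: ${\rm R}(A)$ denotes the set of positive integers that can be written as $x_1a_1+\dots+x_ka_k$ with nonnegative integers $x_i$, and ${\rm NR}(A)$ denotes the (finite) set of positive integers not in ${\rm R}(A)$. $B_n$ are the Bernoulli numbers defined by $\frac{x}{e^x-1}=\sum_{n\ge0}B_n\frac{x^n}{n!}$ (so $B_1=-1/2$). -}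

module Defs where

open import Data.Nat as ℕ using (ℕ; zero; suc; _≤_; _<_; s≤s; z≤n)
open import Data.Nat.Properties using (m^n≢0)
open import Data.Nat.GCD using (gcd)
open import Data.Nat.Combinatorics using (_C_)
open import Data.Integer as ℤ using (ℤ; +_)
open import Data.Integer.Divisibility using () renaming (_∣_ to _∣ℤ_)
open import Data.Rational using (ℚ; _/_; 0ℚ; 1ℚ; -_; _+_; _*_)
open import Data.Fin using (Fin)
import Data.Vec.Functional as VF
open import Data.List using (List; []; _∷_; _++_; [_]; upTo; zipWith; map; foldr)
open import Data.Product using (Σ; _×_)
open import Relation.Binary.PropositionalEquality using (_≡_)
open import Relation.Nullary using (¬_)

sumℚ : List ℚ → ℚ
sumℚ = foldr _+_ 0ℚ

sumℕ : List ℕ → ℕ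
sumℕ = foldr ℕ._+_ 0

-- Σ_{i = lo}^{hi} f i  (empty if hi < lo)
Σ[_to_] : ℕ → ℕ → (ℕ → ℚ) → ℚ
Σ[ lo to hi ] f = sumℚ (map (λ t → f (lo ℕ.+ t)) (upTo (suc hi ℕ.∸ lo)))

-- Bernoulli numbers with B₁ = -1/2:
-- B₀ = 1, B_m = -(1/(m+1)) Σ_{j<m} C(m+1,j) B_j  (equivalent to x/(e^x-1) = Σ B_n x^n/n!)
nextBernoulli : ℕ → List ℚ → ℚ
nextBernoulli m bs =
  - ((+ 1 / suc m) * sumℚ (zipWith (λ j b → (+ (suc m C j) / 1) * b) (upTo m) bs))

bernoulliUpTo : ℕ → List ℚ
bernoulliUpTo zero = 1ℚ ∷ []
bernoulliUpTo (suc n) = bernoulliUpTo n ++ [ nextBernoulli (suc n) (bernoulliUpTo n) ]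

lastOr : ℚ → List ℚ → ℚ
lastOr d [] = d
lastOr d (x ∷ xs) = lastOr x xs

B : ℕ → ℚ
B n = lastOr 0ℚ (bernoulliUpTo n)

-- rational power of a natural number with integer exponent κ - j, i.e. a^κ / a^j
-- (only used with a ≥ 1; the value for a = 0 is irrelevant)
powDiff : ℕ → ℕ → ℕ → ℚ
powDiff zero κ j = 0ℚ
powDiff (suc b) κ j = _/_ (+ (suc b ℕ.^ κ)) (suc b ℕ.^ j) {{m^n≢0 (suc b) j}}

powℚ : ℚ → ℕ → ℚ
powℚ q zero = 1ℚ
powℚ q (suc n) = q * powℚ q n

ℕ→ℚ : ℕ → ℚ
ℕ→ℚ n = + n / 1

ℤ→ℚ : ℤ → ℚ
ℤ→ℚ z = z / 1

gcdAll : {k : ℕ} → (Fin k → ℕ) → ℕ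
gcdAll a = VF.foldr gcd 0 a

InR : {k : ℕ} → (Fin k → ℕ) → ℕ → Set
InR {k} a n = (0 < n) × Σ (Fin k → ℕ) (λ x → VF.foldr ℕ._+_ 0 (λ i → x i ℕ.* a i) ≡ n)

InNR : {k : ℕ} → (Fin k → ℕ) → ℕ → Set
InNR a n = (0 < n) × ¬ InR a n

_≡_[mod_] : ℕ → ℕ → ℕ → Set
x ≡ y [mod d ] = (+ d) ∣ℤ ((+ x) ℤ.- (+ y))

IsLeastRep : {k : ℕ} → (Fin k → ℕ) → ℕ → ℕ → ℕ → Set
IsLeastRep a a₁ i m =
  (0 < m) × (m ≡ i [mod a₁ ]) × InR a m ×
  ((y : ℕ) → 0 < y → y ≡ i [mod a₁ ] → InR a y → m ≤ y)

module Submission where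

-- Write a₁ = a zero and m_i = i + a₁ q_i for the least element of R(A) in the class of i mod a₁
-- (it exists because gcd(A) = 1 lets Bézout reach every class). R(A) is closed under adding a₁,
-- so the non-representable numbers of that class are exactly i + a₁ s for s < q_i, and
--   Σ_{n ∈ NR(A)} n^μ = Σ_i Σ_{s=1}^{q_i} (m_i − a₁ s)^μ.
-- Expanding binomially leaves the power sums Σ_{s=1}^{q} (−s)^κ, which Faulhaber's formula
-- evaluates as a telescoping sum of the Bernoulli polynomial identity B_{κ+1}(x+1) − B_{κ+1}(x) = (κ+1) x^κ.

open import Defs
open import Data.Nat using (ℕ; zero; suc; _≤_; _<_; _^_; _∸_; s≤s; z≤n)
open import Data.Fin using (Fin; zero; suc)
open import Data.List using (List; []; _∷_; _++_; map; applyUpTo; upTo; zipWith; concat)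
open import Data.List.Membership.Propositional using (_∈_)
open import Data.List.Relation.Unary.Unique.Propositional using (Unique)
open import Data.Product using (Σ; _×_; _,_; proj₁; proj₂)
open import Data.Empty using (⊥-elim)
open import Function.Base using (_∘_)
open import Function.Bundles using (_⇔_; mk⇔)
open import Function.Definitions using (Injective)
open import Relation.Binary.PropositionalEquality
open import Relation.Nullary using (yes; no)
open import Relation.Unary using (Decidable)

module Representations where
  open import Data.Nat using (_+_; _*_; pred; _≤?_; _<?_; _≟_; NonZero; >-nonZero)
  open import Data.Nat.Properties
  open import Data.Nat.DivMod using (_%_; _/_; m≡m%n+[m/n]*n; m%n<n; [m+kn]%n≡m%n; m<n⇒m%n≡m)
  open import Data.Nat.Divisibility using (_∣?_)
  open import Data.Nat.GCD using (gcd-GCD; module Bézout)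
  open import Data.Nat.Solver using (module +-*-Solver)
  open import Data.Nat.ListAction using (sum)
  open import Data.Nat.ListAction.Properties using (sum-++; sum-↭)
  import Data.Integer as ℤ
  import Data.Integer.Properties as ℤ
  import Data.Integer.Divisibility.Signed as ℤ
  open import Data.Integer.Solver using () renaming (module +-*-Solver to ℤ-Solver)
  open import Data.Fin using (toℕ; fromℕ<)
  open import Data.Fin.Properties using (any?; toℕ-fromℕ<; toℕ<n)
  import Data.Vec.Functional as Vector
  open import Data.List.Properties using (map-applyUpTo; concat-map)
  open import Data.List.Membership.Propositional.Properties
    using (∈-applyUpTo⁺; ∈-applyUpTo⁻; ∈-concat⁺′; ∈-concat⁻′)
  open import Data.List.Membership.Propositional.Properties.WithK using (unique∧set⇒bag)
  open import Data.List.Relation.Binary.BagAndSetEquality using (∼bag⇒↭)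
  open import Data.List.Relation.Binary.Permutation.Propositional using (_↭_)
  import Data.List.Relation.Binary.Permutation.Propositional.Properties as Perm
  import Data.List.Relation.Unary.All.Properties as All
  import Data.List.Relation.Unary.AllPairs.Properties as AllPairs
  import Data.List.Relation.Unary.Unique.Propositional.Properties as Unique
  import Function.Properties.Equivalence as ⇔
  open import Relation.Nullary.Decidable using (_×-dec_)
  open import Data.List.Relation.Binary.Disjoint.Propositional using (Disjoint)
  open import Data.Nat.Induction using (<-rec)

  combination : ∀ {n} → (Fin n → ℕ) → (Fin n → ℕ) → ℕ
  combination x b = Vector.foldr _+_ 0 (λ i → x i * b i)

  combination-zero : ∀ {n} (b : Fin n → ℕ) → combination (λ _ → 0) b ≡ 0
  combination-zero {zero} b = refl
  combination-zero {suc n} b = combination-zero (b ∘ suc)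

  combination-+ : ∀ {n} (x y b : Fin n → ℕ) →
                  combination (λ i → x i + y i) b ≡ combination x b + combination y b
  combination-+ {zero} x y b = refl
  combination-+ {suc n} x y b = begin
    (x zero + y zero) * b zero + combination (λ i → x (suc i) + y (suc i)) (b ∘ suc)
      ≡⟨ cong₂ _+_ (*-distribʳ-+ (b zero) (x zero) (y zero)) (combination-+ (x ∘ suc) (y ∘ suc) (b ∘ suc)) ⟩
    (x zero * b zero + y zero * b zero) + (combination (x ∘ suc) (b ∘ suc) + combination (y ∘ suc) (b ∘ suc))
      ≡⟨ +-interchange (x zero * b zero) (y zero * b zero) _ _ ⟩
    combination x b + combination y b ∎
    where
    open ≡-Reasoning
    +-interchange : ∀ p q r s → (p + q) + (r + s) ≡ (p + r) + (q + s)
    +-interchange = solve 4 (λ p q r s → (p :+ q) :+ (r :+ s) := (p :+ r) :+ (q :+ s)) refl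
      where open +-*-Solver

  basis : ∀ {n} → Fin n → ℕ → Fin n → ℕ
  basis zero    t zero    = t
  basis zero    t (suc _) = 0
  basis (suc j) t zero    = 0
  basis (suc j) t (suc i) = basis j t i

  combination-basis : ∀ {n} (j : Fin n) t (b : Fin n → ℕ) → combination (basis j t) b ≡ t * b j
  combination-basis {suc n} zero t b = trans (cong (_+_ (t * b zero)) (combination-zero (b ∘ suc))) (+-identityʳ _)
  combination-basis {suc n} (suc j) t b = combination-basis j t (b ∘ suc)

  representable? : ∀ {n} (b : Fin n → ℕ) → (∀ i → 0 < b i) → Decidable (λ y → Σ (Fin n → ℕ) λ x → combination x b ≡ y)
  representable? {zero} b pos y with 0 ≟ y
  ... | yes 0≡y = yes ((λ ()) , 0≡y)
  ... | no 0≢y = no (0≢y ∘ proj₂)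
  representable? {suc n} b pos y with any? (λ (t : Fin (suc y)) → (toℕ t * b zero ≤? y) ×-dec representable? (b ∘ suc) (pos ∘ suc) (y ∸ toℕ t * b zero))
  ... | yes (t , t·b≤y , x , eq) = yes (extend (toℕ t) x , trans (cong (_+_ (toℕ t * b zero)) eq) (m+[n∸m]≡n t·b≤y))
    where
    extend : ℕ → (Fin n → ℕ) → Fin (suc n) → ℕ
    extend t x zero = t
    extend t x (suc i) = x i
  ... | no ¬first = no λ (x , eq) → ¬first (firstCoefficient x eq)
    where
    firstCoefficient : ∀ x → combination x b ≡ y →
                       Σ (Fin (suc y)) λ t → (toℕ t * b zero ≤ y) ×
                                             Σ (Fin n → ℕ) λ x′ → combination x′ (b ∘ suc) ≡ y ∸ toℕ t * b zero
    firstCoefficient x eq = t , subst (λ s → s * b zero ≤ y) (sym t≡x₀) x₀b≤y , x ∘ suc ,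
        subst (λ s → combination (x ∘ suc) (b ∘ suc) ≡ y ∸ s * b zero) (sym t≡x₀)
              (sym (trans (cong (_∸ x zero * b zero) (sym eq)) (m+n∸m≡n (x zero * b zero) _)))
      where
      x₀b≤y : x zero * b zero ≤ y
      x₀b≤y = subst (x zero * b zero ≤_) eq (m≤m+n _ _)
      x₀<1+y : x zero < suc y
      x₀<1+y = s≤s (≤-trans (m≤m*n (x zero) (b zero) {{>-nonZero (pos zero)}}) x₀b≤y)
      t : Fin (suc y)
      t = fromℕ< x₀<1+y
      t≡x₀ : toℕ t ≡ x zero
      t≡x₀ = toℕ-fromℕ< x₀<1+y

  record Congruent (d x y : ℕ) : Set where
    constructor congruent
    field
      u v : ℕ
      equation : x + d * u ≡ y + d * v

  Congruent-refl : ∀ {d x} → Congruent d x x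
  Congruent-refl = congruent 0 0 refl

  Congruent-trans : ∀ {d x y z} → Congruent d x y → Congruent d y z → Congruent d x z
  Congruent-trans {d} {x} {y} {z} (congruent u v x≡y) (congruent u′ v′ y≡z) = congruent (u + u′) (v′ + v) (begin
    x + d * (u + u′)    ≡⟨ shift x d u u′ ⟩
    x + d * u + d * u′  ≡⟨ cong (_+ d * u′) x≡y ⟩
    y + d * v + d * u′  ≡⟨ swap y d v u′ ⟩
    y + d * u′ + d * v  ≡⟨ cong (_+ d * v) y≡z ⟩
    z + d * v′ + d * v  ≡⟨ shift z d v′ v ⟨
    z + d * (v′ + v)    ∎)
    where
    open ≡-Reasoning
    open +-*-Solver
    shift : ∀ w d s t → w + d * (s + t) ≡ w + d * s + d * t
    shift = solve 4 (λ w d s t → w :+ d :* (s :+ t) := w :+ d :* s :+ d :* t) refl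
    swap : ∀ w d s t → w + d * s + d * t ≡ w + d * t + d * s
    swap = solve 4 (λ w d s t → w :+ d :* s :+ d :* t := w :+ d :* t :+ d :* s) refl

  Congruent-+ : ∀ {d x y x′ y′} → Congruent d x y → Congruent d x′ y′ → Congruent d (x + x′) (y + y′)
  Congruent-+ {d} {x} {y} {x′} {y′} (congruent u v x≡y) (congruent u′ v′ x′≡y′) = congruent (u + u′) (v + v′) (begin
    (x + x′) + d * (u + u′)        ≡⟨ regroup x x′ d u u′ ⟩
    (x + d * u) + (x′ + d * u′)    ≡⟨ cong₂ _+_ x≡y x′≡y′ ⟩
    (y + d * v) + (y′ + d * v′)    ≡⟨ regroup y y′ d v v′ ⟨
    (y + y′) + d * (v + v′)        ∎)
    where
    open ≡-Reasoning
    open +-*-Solver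
    regroup : ∀ p p′ d s s′ → (p + p′) + d * (s + s′) ≡ (p + d * s) + (p′ + d * s′)
    regroup = solve 5 (λ p p′ d s s′ → (p :+ p′) :+ d :* (s :+ s′) := (p :+ d :* s) :+ (p′ :+ d :* s′)) refl

  Congruent-+multiple : ∀ d x t → Congruent d (x + d * t) x
  Congruent-+multiple d x t = congruent 0 t (trans (cong (_+_ (x + d * t)) (*-zeroʳ d)) (+-identityʳ _))

  Congruent⇒%≡ : ∀ {d x y} .{{_ : NonZero d}} → Congruent d x y → x % d ≡ y % d
  Congruent⇒%≡ {d} {x} {y} (congruent u v x≡y) = begin
    x % d            ≡⟨ [m+kn]%n≡m%n x u d ⟨
    (x + u * d) % d  ≡⟨ cong (_% d) (trans (cong (x +_) (*-comm u d)) (trans x≡y (cong (y +_) (*-comm d v)))) ⟩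
    (y + v * d) % d  ≡⟨ [m+kn]%n≡m%n y v d ⟩
    y % d            ∎
    where open ≡-Reasoning

  Congruent-residue : ∀ {d x r} .{{_ : NonZero d}} → Congruent d x r → r < d → Σ ℕ λ q → x ≡ r + d * q
  Congruent-residue {d} {x} {r} x≡r r<d = x / d , (begin
    x                  ≡⟨ m≡m%n+[m/n]*n x d ⟩
    x % d + x / d * d  ≡⟨ cong₂ _+_ (trans (Congruent⇒%≡ x≡r) (m<n⇒m%n≡m r<d)) (*-comm (x / d) d) ⟩
    r + d * (x / d)    ∎)
    where open ≡-Reasoning

  Congruent⇒[mod] : ∀ {d x y} → Congruent d x y → x ≡ y [mod d ]
  Congruent⇒[mod] {d} {x} {y} (congruent u v x≡y) =
    ℤ.∣⇒∣ᵤ (ℤ.divides (ℤ.+ v ℤ.- ℤ.+ u) (difference (ℤ.+ x) (ℤ.+ y) (ℤ.+ d) (ℤ.+ u) (ℤ.+ v) x≡yℤ))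
    where
    x≡yℤ : ℤ.+ x ℤ.+ ℤ.+ d ℤ.* ℤ.+ u ≡ ℤ.+ y ℤ.+ ℤ.+ d ℤ.* ℤ.+ v
    x≡yℤ = subst₂ (λ p q → ℤ.+ x ℤ.+ p ≡ ℤ.+ y ℤ.+ q) (ℤ.pos-* d u) (ℤ.pos-* d v) (cong ℤ.+_ x≡y)
    difference : ∀ X Y D U V → X ℤ.+ D ℤ.* U ≡ Y ℤ.+ D ℤ.* V → X ℤ.- Y ≡ (V ℤ.- U) ℤ.* D
    difference X Y D U V eq = begin
      X ℤ.- Y                            ≡⟨ expand X Y D U ⟩
      (X ℤ.+ D ℤ.* U) ℤ.- D ℤ.* U ℤ.- Y  ≡⟨ cong (λ w → w ℤ.- D ℤ.* U ℤ.- Y) eq ⟩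
      (Y ℤ.+ D ℤ.* V) ℤ.- D ℤ.* U ℤ.- Y  ≡⟨ collect Y D U V ⟩
      (V ℤ.- U) ℤ.* D                    ∎
      where
      open ≡-Reasoning
      open ℤ-Solver
      expand : ∀ X Y D U → X ℤ.- Y ≡ (X ℤ.+ D ℤ.* U) ℤ.- D ℤ.* U ℤ.- Y
      expand = solve 4 (λ X Y D U → X :- Y := (X :+ D :* U) :- D :* U :- Y) refl
      collect : ∀ Y D U V → (Y ℤ.+ D ℤ.* V) ℤ.- D ℤ.* U ℤ.- Y ≡ (V ℤ.- U) ℤ.* D
      collect = solve 4 (λ Y D U V → (Y :+ D :* V) :- D :* U :- Y := (V :- U) :* D) refl

  [mod]⇒Congruent : ∀ {d x y} → x ≡ y [mod d ] → Congruent d x y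
  [mod]⇒Congruent {d} {x} {y} x≡y with ℤ.∣ᵤ⇒∣ {ℤ.+ d} {ℤ.+ x ℤ.- ℤ.+ y} x≡y
  ... | ℤ.divides (ℤ.+ t) eq = congruent 0 t (ℤ.+-injective (begin
    ℤ.+ (x + d * 0)                     ≡⟨ cong ℤ.+_ (trans (cong (x +_) (*-zeroʳ d)) (+-identityʳ x)) ⟩
    ℤ.+ x                               ≡⟨ split (ℤ.+ x) (ℤ.+ y) ⟩
    (ℤ.+ y) ℤ.+ ((ℤ.+ x) ℤ.- (ℤ.+ y))   ≡⟨ cong (ℤ._+_ (ℤ.+ y)) eq ⟩
    (ℤ.+ y) ℤ.+ (ℤ.+ t) ℤ.* (ℤ.+ d)     ≡⟨ cong (ℤ._+_ (ℤ.+ y)) (trans (cong ℤ.+_ (*-comm d t)) (ℤ.pos-* t d)) ⟨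
    ℤ.+ (y + d * t)                     ∎))
    where
    open ≡-Reasoning
    split : ∀ X Y → X ≡ Y ℤ.+ (X ℤ.- Y)
    split = solve 2 (λ X Y → X := Y :+ (X :- Y)) refl
      where open ℤ-Solver
  ... | ℤ.divides ℤ.-[1+ t ] eq = congruent (suc t) 0 (sym (ℤ.+-injective (begin
    ℤ.+ (y + d * 0)                     ≡⟨ cong ℤ.+_ (trans (cong (y +_) (*-zeroʳ d)) (+-identityʳ y)) ⟩
    ℤ.+ y                               ≡⟨ split (ℤ.+ x) (ℤ.+ y) ⟩
    (ℤ.+ x) ℤ.- ((ℤ.+ x) ℤ.- (ℤ.+ y))   ≡⟨ cong (ℤ._-_ (ℤ.+ x)) eq ⟩
    (ℤ.+ x) ℤ.- ℤ.-[1+ t ] ℤ.* (ℤ.+ d)  ≡⟨ flip (ℤ.+ x) (ℤ.+ suc t) (ℤ.+ d) ⟩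
    (ℤ.+ x) ℤ.+ (ℤ.+ suc t) ℤ.* (ℤ.+ d) ≡⟨ cong (ℤ._+_ (ℤ.+ x)) (trans (cong ℤ.+_ (*-comm d (suc t))) (ℤ.pos-* (suc t) d)) ⟨
    ℤ.+ (x + d * suc t)                 ∎)))
    where
    open ≡-Reasoning
    open ℤ-Solver
    split : ∀ X Y → Y ≡ X ℤ.- (X ℤ.- Y)
    split = solve 2 (λ X Y → Y := X :- (X :- Y)) refl
    flip : ∀ X T D → X ℤ.- (ℤ.- T) ℤ.* D ≡ X ℤ.+ T ℤ.* D
    flip = solve 3 (λ X T D → X :- (:- T) :* D := X :+ T :* D) refl

  least : {Q : ℕ → Set} → Decidable Q → ∀ y → Q y → Σ ℕ λ m → Q m × (∀ z → Q z → m ≤ z)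
  least {Q} Q? = <-rec (λ y → Q y → Σ ℕ λ m → Q m × (∀ z → Q z → m ≤ z)) search
    where
    search : ∀ y → (∀ {x} → x < y → Q x → Σ ℕ λ m → Q m × (∀ z → Q z → m ≤ z)) →
             Q y → Σ ℕ λ m → Q m × (∀ z → Q z → m ≤ z)
    search y smaller Qy with any? (λ (x : Fin y) → Q? (toℕ x))
    ... | yes (x , Qx) = smaller (toℕ<n x) Qx
    ... | no ¬smaller = y , Qy , λ z Qz → ≮⇒≥ λ z<y → ¬smaller (fromℕ< z<y , subst Q (sym (toℕ-fromℕ< z<y)) Qz)

  choice : {D : ℕ → Set} {R : ℕ → ℕ → Set} → Decidable D → (∀ i → D i → Σ ℕ (R i)) →
           Σ (ℕ → ℕ) λ f → ∀ i → D i → R i (f i)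
  choice {D} {R} D? r = f , f-correct
    where
    f : ℕ → ℕ
    f i with D? i
    ... | yes Di = proj₁ (r i Di)
    ... | no _ = 0
    f-correct : ∀ i → D i → R i (f i)
    f-correct i Di with D? i
    ... | yes Di′ = proj₂ (r i Di′)
    ... | no ¬Di = ⊥-elim (¬Di Di)

  module _ {n} (b : Fin n → ℕ) (N : ℕ) .{{_ : NonZero N}} where

    RepresentedMod : ℕ → Set
    RepresentedMod z = Σ (Fin n → ℕ) λ x → Congruent N (combination x b) z

    RepresentedMod-zero : RepresentedMod 0
    RepresentedMod-zero = (λ _ → 0) , subst (λ w → Congruent N w 0) (sym (combination-zero b)) Congruent-refl

    RepresentedMod-generator : ∀ j c → RepresentedMod (c * b j)
    RepresentedMod-generator j c = basis j c , subst (λ w → Congruent N w (c * b j)) (sym (combination-basis j c b)) Congruent-refl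

    RepresentedMod-+ : ∀ {y z} → RepresentedMod y → RepresentedMod z → RepresentedMod (y + z)
    RepresentedMod-+ (x , x≡y) (x′ , x′≡z) =
      (λ i → x i + x′ i) , subst (λ w → Congruent N w _) (sym (combination-+ x x′ b)) (Congruent-+ x≡y x′≡z)

    RepresentedMod-congruent : ∀ {y z} → RepresentedMod y → Congruent N y z → RepresentedMod z
    RepresentedMod-congruent (x , x≡y) y≡z = x , Congruent-trans x≡y y≡z

    RepresentedMod-bezout : ∀ {d u w} s t → d + s * u ≡ t * w →
                            (∀ c → RepresentedMod (c * u)) → (∀ c → RepresentedMod (c * w)) →
                            ∀ c → RepresentedMod (c * d)
    RepresentedMod-bezout {d} {u} {w} s t bezout multiples-u multiples-w c =
      -- N − 1 copies of c s u stand in for − c s u, which exists only modulo N.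
      RepresentedMod-congruent (RepresentedMod-+ (multiples-w (c * t)) (multiples-u (pred N * (c * s))))
        (subst (λ z → Congruent N z (c * d)) (sym identity) (Congruent-+multiple N (c * d) (c * s * u)))
      where
      open ≡-Reasoning
      expand : ∀ c d s u n → c * (d + s * u) + n * (c * s) * u ≡ c * d + suc n * (c * s * u)
      expand = solve 5 (λ c d s u n → c :* (d :+ s :* u) :+ n :* (c :* s) :* u := c :* d :+ (con 1 :+ n) :* (c :* s :* u)) refl
        where open +-*-Solver
      identity : c * t * w + pred N * (c * s) * u ≡ c * d + N * (c * s * u)
      identity = begin
        c * t * w + pred N * (c * s) * u        ≡⟨ cong (_+ pred N * (c * s) * u) (trans (*-assoc c t w) (cong (c *_) (sym bezout))) ⟩
        c * (d + s * u) + pred N * (c * s) * u  ≡⟨ expand c d s u (pred N) ⟩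
        c * d + suc (pred N) * (c * s * u)      ≡⟨ cong (λ m → c * d + m * (c * s * u)) (suc-pred N) ⟩
        c * d + N * (c * s * u)                 ∎

  RepresentedMod-tail : ∀ {n} (b : Fin (suc n) → ℕ) N .{{_ : NonZero N}} {z} →
                       RepresentedMod (b ∘ suc) N z → RepresentedMod b N z
  RepresentedMod-tail b N (x , x≡z) = (λ { zero → 0 ; (suc i) → x i }) , x≡z

  RepresentedMod-gcdAll : ∀ {n} (b : Fin n → ℕ) N .{{_ : NonZero N}} → ∀ c → RepresentedMod b N (c * gcdAll b)
  RepresentedMod-gcdAll {zero} b N c = subst (RepresentedMod b N) (sym (*-zeroʳ c)) (RepresentedMod-zero b N)
  RepresentedMod-gcdAll {suc n} b N with Bézout.identity (gcd-GCD (b zero) (gcdAll (b ∘ suc)))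
  ... | Bézout.+- x y bezout = RepresentedMod-bezout b N y x bezout tail (RepresentedMod-generator b N zero)
    where
    tail : ∀ c → RepresentedMod b N (c * gcdAll (b ∘ suc))
    tail = RepresentedMod-tail b N ∘ RepresentedMod-gcdAll (b ∘ suc) N
  ... | Bézout.-+ x y bezout = RepresentedMod-bezout b N x y bezout (RepresentedMod-generator b N zero) tail
    where
    tail : ∀ c → RepresentedMod b N (c * gcdAll (b ∘ suc))
    tail = RepresentedMod-tail b N ∘ RepresentedMod-gcdAll (b ∘ suc) N

  [r+d*s]%d≡r : ∀ {d r} s .{{_ : NonZero d}} → r < d → (r + d * s) % d ≡ r
  [r+d*s]%d≡r {d} {r} s r<d = trans (cong (λ t → (r + t) % d) (*-comm d s)) (trans ([m+kn]%n≡m%n r s d) (m<n⇒m%n≡m r<d))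

  sum-concat : ∀ xss → sum (concat xss) ≡ sum (map sum xss)
  sum-concat [] = refl
  sum-concat (xs ∷ xss) = trans (sum-++ xs (concat xss)) (cong (sum xs +_) (sum-concat xss))

  module _ {k} (a : Fin (suc k) → ℕ) (pos : ∀ i → 0 < a i) where
    private
      N : ℕ
      N = a zero
      instance
        N≢0 : NonZero N
        N≢0 = >-nonZero (pos zero)

    InR-multiple : ∀ t → 0 < N * t → InR a (N * t)
    InR-multiple t 0<Nt = 0<Nt , basis zero t , trans (combination-basis zero t a) (*-comm t N)

    InR-+multiple : ∀ {y} t → InR a y → InR a (y + N * t)
    InR-+multiple {y} t (0<y , x , x≡y) = <-≤-trans 0<y (m≤m+n y _) , (λ i → x i + basis zero t i) , (begin
      combination (λ i → x i + basis zero t i) a     ≡⟨ combination-+ x (basis zero t) a ⟩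
      combination x a + combination (basis zero t) a ≡⟨ cong₂ _+_ x≡y (combination-basis zero t a) ⟩
      y + t * N                                      ≡⟨ cong (y +_) (*-comm t N) ⟩
      y + N * t                                      ∎)
      where open ≡-Reasoning

    leastRep-exists : gcdAll a ≡ 1 → ∀ i → 1 ≤ i → i < N → Σ ℕ (IsLeastRep a N i)
    leastRep-exists gcd≡1 i 1≤i i<N =
      let (m , (0<m , m≡i , m∈R) , m-least) = least candidate? y (0<y , Congruent⇒[mod] y≡i , 0<y , x , refl)
      in m , 0<m , m≡i , m∈R , λ z 0<z z≡i z∈R → m-least z (0<z , z≡i , z∈R)
      where
      candidate? : Decidable (λ y → (0 < y) × (y ≡ i [mod N ]) × InR a y)
      candidate? y = 0 <? y ×-dec (N ∣? ℤ.∣ ℤ.+ y ℤ.- ℤ.+ i ∣) ×-dec (0 <? y ×-dec representable? a pos y)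
      i-represented : RepresentedMod a N i
      i-represented = subst (RepresentedMod a N) (trans (cong (i *_) gcd≡1) (*-identityʳ i)) (RepresentedMod-gcdAll a N i)
      x : Fin (suc k) → ℕ
      x = proj₁ i-represented
      y : ℕ
      y = combination x a
      y≡i : Congruent N y i
      y≡i = proj₂ i-represented
      i≡0 : y ≡ 0 → i ≡ 0
      i≡0 y≡0 = begin
        i      ≡⟨ m<n⇒m%n≡m i<N ⟨
        i % N  ≡⟨ Congruent⇒%≡ y≡i ⟨
        y % N  ≡⟨ cong (_% N) y≡0 ⟩
        0 % N  ≡⟨ m<n⇒m%n≡m (pos zero) ⟩
        0      ∎
        where open ≡-Reasoning
      0<y : 0 < y
      0<y = n≢0⇒n>0 λ y≡0 → <⇒≢ 1≤i (sym (i≡0 y≡0))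

    leastReps : gcdAll a ≡ 1 → Σ (ℕ → ℕ) λ m → ∀ i → 1 ≤ i → i < N → IsLeastRep a N i (m i)
    leastReps gcd≡1 =
      let (m , m-least) = choice (λ i → 1 ≤? i ×-dec i <? N) (λ i (1≤i , i<N) → leastRep-exists gcd≡1 i 1≤i i<N)
      in m , λ i 1≤i i<N → m-least i (1≤i , i<N)

    module _ (m : ℕ → ℕ) (m-least : ∀ i → 1 ≤ i → i < N → IsLeastRep a N i (m i)) where

      private
        quotients : Σ (ℕ → ℕ) λ q → ∀ i → 1 ≤ i × i < N → m i ≡ i + N * q i
        quotients = choice (λ i → 1 ≤? i ×-dec i <? N)
          λ i (1≤i , i<N) → Congruent-residue ([mod]⇒Congruent (proj₁ (proj₂ (m-least i 1≤i i<N)))) i<N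

      quotient : ℕ → ℕ
      quotient = proj₁ quotients

      leastRep≡i+N*quotient : ∀ i → 1 ≤ i → i < N → m i ≡ i + N * quotient i
      leastRep≡i+N*quotient i 1≤i i<N = proj₂ quotients i (1≤i , i<N)

      gapsOf : ℕ → List ℕ
      gapsOf i = applyUpTo (λ s → i + N * s) (quotient i)

      gaps : List ℕ
      gaps = concat (applyUpTo (gapsOf ∘ suc) (N ∸ 1))

      gaps-unique : Unique gaps
      gaps-unique = Unique.concat⁺ (All.applyUpTo⁺₁ (gapsOf ∘ suc) (N ∸ 1) λ _ → gapsOf-unique)
                                   (AllPairs.applyUpTo⁺₁ (gapsOf ∘ suc) (N ∸ 1) gapsOf-disjoint)
        where
        gapsOf-unique : ∀ {i} → Unique (gapsOf i)
        gapsOf-unique {i} = Unique.applyUpTo⁺₁ _ (quotient i) λ s<t _ eq → <⇒≢ s<t (*-cancelˡ-≡ _ _ N (+-cancelˡ-≡ i _ _ eq))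
        gapsOf-disjoint : ∀ {u u′} → u < u′ → u′ < N ∸ 1 → Disjoint (gapsOf (suc u)) (gapsOf (suc u′))
        gapsOf-disjoint {u} {u′} u<u′ u′<N∸1 (v∈ , v∈′) with ∈-applyUpTo⁻ _ v∈ | ∈-applyUpTo⁻ _ v∈′
        ... | s , _ , refl | s′ , _ , eq = <⇒≢ u<u′ (suc-injective (begin
          suc u                          ≡⟨ [r+d*s]%d≡r s (pred-cancel-< (<-trans u<u′ u′<N∸1)) ⟨
          (suc u + N * s) % N            ≡⟨ cong (_% N) eq ⟩
          (suc u′ + N * s′) % N          ≡⟨ [r+d*s]%d≡r s′ (pred-cancel-< u′<N∸1) ⟩
          suc u′                         ∎))
          where open ≡-Reasoning

      gaps⊆NR : ∀ {n} → n ∈ gaps → InNR a n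
      gaps⊆NR n∈gaps with ∈-concat⁻′ (applyUpTo (gapsOf ∘ suc) (N ∸ 1)) n∈gaps
      ... | xs , n∈xs , xs∈ with ∈-applyUpTo⁻ (gapsOf ∘ suc) xs∈
      ... | u , u<N∸1 , refl with ∈-applyUpTo⁻ _ n∈xs
      ... | s , s<q , refl = s≤s z≤n , λ n∈R → <⇒≱ n<m (proj₂ (proj₂ (proj₂ (m-least i (s≤s z≤n) i<N))) _ (s≤s z≤n) n≡i n∈R)
        where
        i : ℕ
        i = suc u
        i<N : i < N
        i<N = pred-cancel-< u<N∸1
        n≡i : (i + N * s) ≡ i [mod N ]
        n≡i = Congruent⇒[mod] (Congruent-+multiple N i s)
        n<m : i + N * s < m i
        n<m = subst (i + N * s <_) (sym (leastRep≡i+N*quotient i (s≤s z≤n) i<N)) (+-monoʳ-< i (*-monoʳ-< N s<q))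

      NR⊆gaps : ∀ {n} → InNR a n → n ∈ gaps
      NR⊆gaps {n} (0<n , n∉R) = locate (n % N) (n / N) (m%n<n n N) (m≡m%n+[m/n]*n n N)
        where
        locate : ∀ r s → r < N → n ≡ r + s * N → n ∈ gaps
        locate zero s _ n≡sN = ⊥-elim (n∉R (subst (InR a) (sym n≡Ns) (InR-multiple s (subst (0 <_) n≡Ns 0<n))))
          where
          n≡Ns : n ≡ N * s
          n≡Ns = trans n≡sN (*-comm s N)
        locate (suc u) s i<N n≡i+sN with quotient (suc u) ≤? s
        ... | yes q≤s = ⊥-elim (n∉R (subst (InR a) m+N[s∸q]≡n (InR-+multiple (s ∸ q) m∈R)))
          where
          i q : ℕ
          i = suc u
          q = quotient i
          m∈R : InR a (m i)
          m∈R = proj₁ (proj₂ (proj₂ (m-least i (s≤s z≤n) i<N)))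
          m+N[s∸q]≡n : m i + N * (s ∸ q) ≡ n
          m+N[s∸q]≡n = begin
            m i + N * (s ∸ q)        ≡⟨ cong (_+ N * (s ∸ q)) (leastRep≡i+N*quotient i (s≤s z≤n) i<N) ⟩
            i + N * q + N * (s ∸ q)  ≡⟨ +-assoc i (N * q) _ ⟩
            i + (N * q + N * (s ∸ q)) ≡⟨ cong (i +_) (sym (*-distribˡ-+ N q (s ∸ q))) ⟩
            i + N * (q + (s ∸ q))    ≡⟨ cong (λ t → i + N * t) (m+[n∸m]≡n q≤s) ⟩
            i + N * s                ≡⟨ cong (i +_) (*-comm N s) ⟩
            i + s * N                ≡⟨ n≡i+sN ⟨
            n                        ∎
            where open ≡-Reasoning
        ... | no q≰s = ∈-concat⁺′ (subst (_∈ gapsOf (suc u)) (sym n≡i+Ns) (∈-applyUpTo⁺ _ (≰⇒> q≰s)))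
                                  (∈-applyUpTo⁺ (gapsOf ∘ suc) (<⇒≤pred i<N))
          where
          n≡i+Ns : n ≡ suc u + N * s
          n≡i+Ns = trans n≡i+sN (cong (suc u +_) (*-comm s N))

      sum-NR : (f : ℕ → ℕ) (L : List ℕ) → Unique L → (∀ n → (n ∈ L) ⇔ InNR a n) →
               sum (map f L) ≡ sum (map (λ i → sum (map f (gapsOf i))) (applyUpTo suc (N ∸ 1)))
      sum-NR f L L-unique L≡NR = begin
        sum (map f L)                                         ≡⟨ sum-↭ (Perm.map⁺ f L↭gaps) ⟩
        sum (map f gaps)                                      ≡⟨ cong sum (concat-map blocks) ⟨
        sum (concat (map (map f) blocks))                     ≡⟨ sum-concat (map (map f) blocks) ⟩
        sum (map sum (map (map f) blocks))                    ≡⟨ cong sum (trans (cong (map sum) (map-applyUpTo _ (map f) (N ∸ 1))) (map-applyUpTo _ sum (N ∸ 1))) ⟩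
        sum (applyUpTo (sum ∘ map f ∘ gapsOf ∘ suc) (N ∸ 1))   ≡⟨ cong sum (map-applyUpTo suc _ (N ∸ 1)) ⟨
        sum (map (λ i → sum (map f (gapsOf i))) (applyUpTo suc (N ∸ 1))) ∎
        where
        open ≡-Reasoning
        blocks : List (List ℕ)
        blocks = applyUpTo (gapsOf ∘ suc) (N ∸ 1)
        L↭gaps : L ↭ gaps
        L↭gaps = ∼bag⇒↭ (unique∧set⇒bag L-unique gaps-unique λ {n} → ⇔.trans (L≡NR n) (mk⇔ NR⊆gaps gaps⊆NR))

open Representations

import Data.Nat as ℕ
import Data.Nat.Properties as ℕ
import Data.Nat.Solver
open import Data.Nat.DivMod using (m/n*n≡m)
open import Data.Nat.ListAction using (sum)
open import Data.Nat.Combinatorics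
  using (_C_; k>n⇒nCk≡0; nCk+nC[k+1]≡[n+1]C[k+1]; nCk≡nC[n∸k]; nC1≡n; nCn≡1; k![n∸k]!∣n!)
open import Data.Nat.Combinatorics.Specification using (nCk≡n!/k![n-k]!)
open import Data.Integer as ℤ using (ℤ; +_)
import Data.Integer.Properties as ℤ
open import Data.Integer.Solver using () renaming (module +-*-Solver to ℤ-Solver)
open import Data.Rational using (ℚ; _/_; 0ℚ; 1ℚ; -_; _+_; _*_; _-_; toℚᵘ)
open import Data.Rational.Properties
  using (toℚᵘ-injective; toℚᵘ-fromℚᵘ; toℚᵘ-homo-+; toℚᵘ-homo-*; +-assoc; +-comm; +-identityˡ; +-identityʳ;
         *-distribˡ-+; *-distribʳ-+; *-zeroˡ; *-zeroʳ; *-identityˡ; *-identityʳ; *-assoc; *-comm)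
import Data.Rational.Unnormalised as ℚᵘ
import Data.Rational.Unnormalised.Properties as ℚᵘ
open import Data.Rational.Solver using (module +-*-Solver)
open import Data.List.Properties using (map-applyUpTo; applyUpTo-∷ʳ)

toℚᵘ-ℤ→ℚ : ∀ z → toℚᵘ (ℤ→ℚ z) ℚᵘ.≃ ℚᵘ.mkℚᵘ z 0
toℚᵘ-ℤ→ℚ z = toℚᵘ-fromℚᵘ (ℚᵘ.mkℚᵘ z 0)

ℤ→ℚ-+ : ∀ x y → ℤ→ℚ (x ℤ.+ y) ≡ ℤ→ℚ x + ℤ→ℚ y
ℤ→ℚ-+ x y = toℚᵘ-injective (begin
  toℚᵘ (ℤ→ℚ (x ℤ.+ y))                    ≈⟨ toℚᵘ-ℤ→ℚ (x ℤ.+ y) ⟩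
  ℚᵘ.mkℚᵘ (x ℤ.+ y) 0                     ≈⟨ ℚᵘ.*≡* (unit x y) ⟩
  ℚᵘ.mkℚᵘ x 0 ℚᵘ.+ ℚᵘ.mkℚᵘ y 0             ≈⟨ ℚᵘ.+-cong (toℚᵘ-ℤ→ℚ x) (toℚᵘ-ℤ→ℚ y) ⟨
  toℚᵘ (ℤ→ℚ x) ℚᵘ.+ toℚᵘ (ℤ→ℚ y)           ≈⟨ toℚᵘ-homo-+ (ℤ→ℚ x) (ℤ→ℚ y) ⟨
  toℚᵘ (ℤ→ℚ x + ℤ→ℚ y)                    ∎)
  where
  open ℚᵘ.≃-Reasoning
  unit : ∀ x y → (x ℤ.+ y) ℤ.* + 1 ≡ (x ℤ.* + 1 ℤ.+ y ℤ.* + 1) ℤ.* (+ 1 ℤ.* + 1)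
  unit = solve 2 (λ x y → (x :+ y) :* con (+ 1) := (x :* con (+ 1) :+ y :* con (+ 1)) :* (con (+ 1) :* con (+ 1))) refl
    where open ℤ-Solver

ℤ→ℚ-* : ∀ x y → ℤ→ℚ (x ℤ.* y) ≡ ℤ→ℚ x * ℤ→ℚ y
ℤ→ℚ-* x y = toℚᵘ-injective (begin
  toℚᵘ (ℤ→ℚ (x ℤ.* y))                    ≈⟨ toℚᵘ-ℤ→ℚ (x ℤ.* y) ⟩
  ℚᵘ.mkℚᵘ (x ℤ.* y) 0                     ≈⟨ ℚᵘ.*≡* (unit x y) ⟩
  ℚᵘ.mkℚᵘ x 0 ℚᵘ.* ℚᵘ.mkℚᵘ y 0             ≈⟨ ℚᵘ.*-cong (toℚᵘ-ℤ→ℚ x) (toℚᵘ-ℤ→ℚ y) ⟨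
  toℚᵘ (ℤ→ℚ x) ℚᵘ.* toℚᵘ (ℤ→ℚ y)           ≈⟨ toℚᵘ-homo-* (ℤ→ℚ x) (ℤ→ℚ y) ⟨
  toℚᵘ (ℤ→ℚ x * ℤ→ℚ y)                    ∎)
  where
  open ℚᵘ.≃-Reasoning
  unit : ∀ x y → (x ℤ.* y) ℤ.* + 1 ≡ (x ℤ.* y) ℤ.* (+ 1 ℤ.* + 1)
  unit = solve 2 (λ x y → (x :* y) :* con (+ 1) := (x :* y) :* (con (+ 1) :* con (+ 1))) refl
    where open ℤ-Solver

ℕ→ℚ-+ : ∀ m n → ℕ→ℚ (m ℕ.+ n) ≡ ℕ→ℚ m + ℕ→ℚ n
ℕ→ℚ-+ m n = ℤ→ℚ-+ (+ m) (+ n)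

ℕ→ℚ-* : ∀ m n → ℕ→ℚ (m ℕ.* n) ≡ ℕ→ℚ m * ℕ→ℚ n
ℕ→ℚ-* m n = trans (cong ℤ→ℚ (ℤ.pos-* m n)) (ℤ→ℚ-* (+ m) (+ n))

ℤ→ℚ-[i+n]-i : ∀ i n → ℤ→ℚ (+ (i ℕ.+ n) ℤ.- + i) ≡ ℕ→ℚ n
ℤ→ℚ-[i+n]-i i n = cong ℤ→ℚ (trans (cong (ℤ._- + i) (ℤ.pos-+ i n)) (solve 2 (λ i n → (i :+ n) :- i := n) refl (+ i) (+ n)))
  where open ℤ-Solver

ℕ→ℚ-^ : ∀ m n → ℕ→ℚ (m ^ n) ≡ powℚ (ℕ→ℚ m) n
ℕ→ℚ-^ m zero = refl
ℕ→ℚ-^ m (suc n) = trans (ℕ→ℚ-* m (m ^ n)) (cong (ℕ→ℚ m *_) (ℕ→ℚ-^ m n))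

[x/d]*d≡x : ∀ x d .{{_ : ℕ.NonZero d}} → (+ x / d) * ℕ→ℚ d ≡ ℕ→ℚ x
[x/d]*d≡x x d@(suc d-1) = toℚᵘ-injective (begin
  toℚᵘ ((+ x / d) * ℕ→ℚ d)                  ≈⟨ toℚᵘ-homo-* (+ x / d) (ℕ→ℚ d) ⟩
  toℚᵘ (+ x / d) ℚᵘ.* toℚᵘ (ℕ→ℚ d)           ≈⟨ ℚᵘ.*-cong (toℚᵘ-fromℚᵘ (ℚᵘ.mkℚᵘ (+ x) d-1)) (toℚᵘ-ℤ→ℚ (+ d)) ⟩
  ℚᵘ.mkℚᵘ (+ x) d-1 ℚᵘ.* ℚᵘ.mkℚᵘ (+ d) 0     ≈⟨ ℚᵘ.*≡* (cancel (+ x) (+ d)) ⟩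
  ℚᵘ.mkℚᵘ (+ x) 0                          ≈⟨ toℚᵘ-ℤ→ℚ (+ x) ⟨
  toℚᵘ (ℕ→ℚ x)                             ∎)
  where
  open ℚᵘ.≃-Reasoning
  cancel : ∀ a b → (a ℤ.* b) ℤ.* + 1 ≡ a ℤ.* (b ℤ.* + 1)
  cancel = solve 2 (λ a b → (a :* b) :* con (+ 1) := a :* (b :* con (+ 1))) refl
    where open ℤ-Solver

-- Finite sums

∑< : ℕ → (ℕ → ℚ) → ℚ
∑< zero f = 0ℚ
∑< (suc n) f = f 0 + ∑< n (f ∘ suc)

sumℚ-applyUpTo : ∀ f n → sumℚ (applyUpTo f n) ≡ ∑< n f
sumℚ-applyUpTo f zero = refl
sumℚ-applyUpTo f (suc n) = cong (_+_ (f 0)) (sumℚ-applyUpTo (f ∘ suc) n)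

ℕ→ℚ-sum-map-applyUpTo : ∀ (f g : ℕ → ℕ) n → ℕ→ℚ (sum (map f (applyUpTo g n))) ≡ ∑< n (λ t → ℕ→ℚ (f (g t)))
ℕ→ℚ-sum-map-applyUpTo f g zero = refl
ℕ→ℚ-sum-map-applyUpTo f g (suc n) =
  trans (ℕ→ℚ-+ (f (g 0)) _) (cong (_+_ (ℕ→ℚ (f (g 0)))) (ℕ→ℚ-sum-map-applyUpTo f (g ∘ suc) n))

Σ[to]≡∑< : ∀ lo hi f → Σ[ lo to hi ] f ≡ ∑< (suc hi ∸ lo) (λ t → f (lo ℕ.+ t))
Σ[to]≡∑< lo hi f = trans (cong sumℚ (map-applyUpTo (λ t → t) _ (suc hi ∸ lo))) (sumℚ-applyUpTo _ (suc hi ∸ lo))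

∑<-cong-< : ∀ n {f g : ℕ → ℚ} → (∀ t → t < n → f t ≡ g t) → ∑< n f ≡ ∑< n g
∑<-cong-< zero f≡g = refl
∑<-cong-< (suc n) f≡g = cong₂ _+_ (f≡g 0 (s≤s z≤n)) (∑<-cong-< n (λ t t<n → f≡g (suc t) (s≤s t<n)))

∑<-cong : ∀ n {f g : ℕ → ℚ} → (∀ t → f t ≡ g t) → ∑< n f ≡ ∑< n g
∑<-cong n f≡g = ∑<-cong-< n (λ t _ → f≡g t)

∑<-zero : ∀ n → ∑< n (λ _ → 0ℚ) ≡ 0ℚ
∑<-zero zero = refl
∑<-zero (suc n) = trans (+-identityˡ _) (∑<-zero n)

∑<-+ : ∀ n (f g : ℕ → ℚ) → ∑< n (λ t → f t + g t) ≡ ∑< n f + ∑< n g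
∑<-+ zero f g = sym (+-identityˡ 0ℚ)
∑<-+ (suc n) f g = trans (cong (_+_ (f 0 + g 0)) (∑<-+ n (f ∘ suc) (g ∘ suc))) (interchange (f 0) (g 0) _ _)
  where
  interchange : ∀ a b c d → (a + b) + (c + d) ≡ (a + c) + (b + d)
  interchange = solve 4 (λ a b c d → (a :+ b) :+ (c :+ d) := (a :+ c) :+ (b :+ d)) refl
    where open +-*-Solver

*-∑< : ∀ n c (f : ℕ → ℚ) → c * ∑< n f ≡ ∑< n (λ t → c * f t)
*-∑< zero c f = *-zeroʳ c
*-∑< (suc n) c f = trans (*-distribˡ-+ c (f 0) _) (cong (_+_ (c * f 0)) (*-∑< n c (f ∘ suc)))

∑<-snoc : ∀ n (f : ℕ → ℚ) → ∑< (suc n) f ≡ ∑< n f + f n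
∑<-snoc zero f = trans (+-identityʳ (f 0)) (sym (+-identityˡ (f 0)))
∑<-snoc (suc n) f = trans (cong (_+_ (f 0)) (∑<-snoc n (f ∘ suc))) (sym (+-assoc (f 0) _ _))

∑<-swap : ∀ m n (f : ℕ → ℕ → ℚ) → ∑< m (λ s → ∑< n (f s)) ≡ ∑< n (λ t → ∑< m (λ s → f s t))
∑<-swap zero n f = sym (∑<-zero n)
∑<-swap (suc m) n f = trans (cong (_+_ (∑< n (f 0))) (∑<-swap m n (f ∘ suc))) (sym (∑<-+ n (f 0) _))

∑<-interchange₃ : ∀ m (n : ℕ → ℕ) p (c : ℕ → ℕ → ℚ) (g : ℕ → ℕ → ℕ → ℚ) →
  ∑< m (λ s → ∑< (n s) (λ t → c s t * ∑< p (g s t))) ≡ ∑< p (λ u → ∑< m (λ s → ∑< (n s) (λ t → c s t * g s t u)))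
∑<-interchange₃ m n p c g = begin
  ∑< m (λ s → ∑< (n s) (λ t → c s t * ∑< p (g s t)))      ≡⟨ ∑<-cong m (λ s → ∑<-cong (n s) (λ t → *-∑< p (c s t) (g s t))) ⟩
  ∑< m (λ s → ∑< (n s) (λ t → ∑< p (λ u → c s t * g s t u))) ≡⟨ ∑<-cong m (λ s → ∑<-swap (n s) p (λ t u → c s t * g s t u)) ⟩
  ∑< m (λ s → ∑< p (λ u → ∑< (n s) (λ t → c s t * g s t u))) ≡⟨ ∑<-swap m p (λ s u → ∑< (n s) (λ t → c s t * g s t u)) ⟩
  ∑< p (λ u → ∑< m (λ s → ∑< (n s) (λ t → c s t * g s t u))) ∎
  where open ≡-Reasoning

∑<-reverse : ∀ n (f : ℕ → ℚ) → ∑< n f ≡ ∑< n (λ t → f (n ∸ suc t))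
∑<-reverse zero f = refl
∑<-reverse (suc n) f = begin
  f 0 + ∑< n (f ∘ suc)                     ≡⟨ cong (_+_ (f 0)) (∑<-reverse n (f ∘ suc)) ⟩
  f 0 + ∑< n (λ t → f (suc (n ∸ suc t)))   ≡⟨ +-comm (f 0) _ ⟩
  ∑< n (λ t → f (suc (n ∸ suc t))) + f 0   ≡⟨ cong₂ _+_ (∑<-cong-< n (λ t t<n → cong f (sym (ℕ.+-∸-assoc 1 t<n))))
                                                        (cong f (sym (ℕ.n∸n≡0 n))) ⟩
  ∑< n (λ t → f (n ∸ t)) + f (n ∸ n)       ≡⟨ ∑<-snoc n (λ t → f (n ∸ t)) ⟨
  ∑< (suc n) (λ t → f (suc n ∸ suc t))     ∎
  where open ≡-Reasoning

∑<-triangle : ∀ n (g : ℕ → ℕ → ℚ) →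
              ∑< n (λ j → ∑< j (g j)) ≡ ∑< n (λ l → ∑< (n ∸ suc l) (λ r → g (suc l ℕ.+ r) l))
∑<-triangle zero g = refl
∑<-triangle (suc n) g = begin
  ∑< (suc n) (λ j → ∑< j (g j))                                    ≡⟨ ∑<-snoc n _ ⟩
  ∑< n (λ j → ∑< j (g j)) + ∑< n (g n)                             ≡⟨ cong (_+ ∑< n (g n)) (∑<-triangle n g) ⟩
  ∑< n (λ l → column n l) + ∑< n (g n)                              ≡⟨ ∑<-+ n _ _ ⟨
  ∑< n (λ l → column n l + g n l)                                   ≡⟨ ∑<-cong-< n extend ⟩
  ∑< n (λ l → column (suc n) l)                                     ≡⟨ +-identityʳ _ ⟨
  ∑< n (λ l → column (suc n) l) + 0ℚ
    ≡⟨ cong (λ k → ∑< n (λ l → column (suc n) l) + ∑< k (λ r → g (suc n ℕ.+ r) n)) (ℕ.n∸n≡0 n) ⟨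
  ∑< n (λ l → column (suc n) l) + column (suc n) n                  ≡⟨ ∑<-snoc n _ ⟨
  ∑< (suc n) (λ l → column (suc n) l)                               ∎
  where
  open ≡-Reasoning
  column : ℕ → ℕ → ℚ
  column m l = ∑< (m ∸ suc l) (λ r → g (suc l ℕ.+ r) l)
  extend : ∀ l → l < n → column n l + g n l ≡ column (suc n) l
  extend l l<n = begin
    column n l + g n l                                    ≡⟨ cong (λ j → column n l + g j l) (ℕ.m+[n∸m]≡n l<n) ⟨
    column n l + g (suc l ℕ.+ (n ∸ suc l)) l              ≡⟨ ∑<-snoc (n ∸ suc l) _ ⟨
    ∑< (suc (n ∸ suc l)) (λ r → g (suc l ℕ.+ r) l)        ≡⟨ cong (λ k → ∑< k (λ r → g (suc l ℕ.+ r) l)) (ℕ.+-∸-assoc 1 l<n) ⟨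
    column (suc n) l                                      ∎

powℚ-* : ∀ x y n → powℚ (x * y) n ≡ powℚ x n * powℚ y n
powℚ-* x y zero = refl
powℚ-* x y (suc n) = trans (cong ((x * y) *_) (powℚ-* x y n)) (interchange x y (powℚ x n) (powℚ y n))
  where
  interchange : ∀ a b c d → (a * b) * (c * d) ≡ (a * c) * (b * d)
  interchange = solve 4 (λ a b c d → (a :* b) :* (c :* d) := (a :* c) :* (b :* d)) refl
    where open +-*-Solver

powℚ-zeroˡ : ∀ n → powℚ 0ℚ (suc n) ≡ 0ℚ
powℚ-zeroˡ n = *-zeroˡ (powℚ 0ℚ n)

powℚ-oneˡ : ∀ n → powℚ 1ℚ n ≡ 1ℚ
powℚ-oneˡ zero = refl
powℚ-oneˡ (suc n) = trans (*-identityˡ _) (powℚ-oneˡ n)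

binomial : ∀ n x y → powℚ (x + y) n ≡ ∑< (suc n) (λ k → ℕ→ℚ (n C k) * powℚ x k * powℚ y (n ∸ k))
binomial zero x y = sym (trans (+-identityʳ _) (*-identityˡ _))
binomial (suc n) x y = begin
  (x + y) * powℚ (x + y) n                                  ≡⟨ cong ((x + y) *_) (binomial n x y) ⟩
  (x + y) * ∑< (suc n) term                                 ≡⟨ *-distribʳ-+ _ x y ⟩
  x * ∑< (suc n) term + y * ∑< (suc n) term                 ≡⟨ cong₂ _+_ (*-∑< (suc n) x term) (*-∑< (suc n) y term) ⟩
  ∑< (suc n) (λ k → x * term k) + (y * term 0 + ∑< n (λ k → y * term (suc k)))
    ≡⟨ cong (λ s → ∑< (suc n) (λ k → x * term k) + (y * term 0 + s)) (trans (∑<-cong-< n y*term) (sym shifted-top)) ⟩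
  ∑< (suc n) (λ k → x * term k) + (y * term 0 + ∑< (suc n) shifted)
    ≡⟨ rotate (∑< (suc n) (λ k → x * term k)) (y * term 0) _ ⟩
  y * term 0 + (∑< (suc n) (λ k → x * term k) + ∑< (suc n) shifted)
    ≡⟨ cong (_+_ (y * term 0)) (∑<-+ (suc n) (λ k → x * term k) shifted) ⟨
  y * term 0 + ∑< (suc n) (λ k → x * term k + shifted k)    ≡⟨ cong₂ _+_ (lowest y (powℚ y n)) (∑<-cong (suc n) pascal) ⟩
  ∑< (suc (suc n)) (λ k → ℕ→ℚ (suc n C k) * powℚ x k * powℚ y (suc n ∸ k)) ∎
  where
  open ≡-Reasoning
  open +-*-Solver
  term shifted : ℕ → ℚ
  term k = ℕ→ℚ (n C k) * powℚ x k * powℚ y (n ∸ k)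
  shifted k = ℕ→ℚ (n C suc k) * powℚ x (suc k) * powℚ y (n ∸ k)
  rotate : ∀ a b c → a + (b + c) ≡ b + (a + c)
  rotate = solve 3 (λ a b c → a :+ (b :+ c) := b :+ (a :+ c)) refl
  shifted-top : ∑< (suc n) shifted ≡ ∑< n shifted
  shifted-top = begin
    ∑< (suc n) shifted                                      ≡⟨ ∑<-snoc n shifted ⟩
    ∑< n shifted + ℕ→ℚ (n C suc n) * powℚ x (suc n) * powℚ y (n ∸ n)
      ≡⟨ cong (λ c → ∑< n shifted + ℕ→ℚ c * powℚ x (suc n) * powℚ y (n ∸ n)) (k>n⇒nCk≡0 (ℕ.n<1+n n)) ⟩
    ∑< n shifted + 0ℚ * powℚ x (suc n) * powℚ y (n ∸ n)     ≡⟨ cong (_+_ (∑< n shifted)) (zeroˡ (powℚ x (suc n)) (powℚ y (n ∸ n))) ⟩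
    ∑< n shifted + 0ℚ                                        ≡⟨ +-identityʳ _ ⟩
    ∑< n shifted                                             ∎
    where
    zeroˡ : ∀ a b → 0ℚ * a * b ≡ 0ℚ
    zeroˡ = solve 2 (λ a b → con 0ℚ :* a :* b := con 0ℚ) refl
  y*term : ∀ k → k < n → y * term (suc k) ≡ shifted k
  y*term k k<n = begin
    y * (ℕ→ℚ (n C suc k) * powℚ x (suc k) * powℚ y (n ∸ suc k))  ≡⟨ absorb y (ℕ→ℚ (n C suc k) * powℚ x (suc k)) _ ⟩
    ℕ→ℚ (n C suc k) * powℚ x (suc k) * powℚ y (suc (n ∸ suc k))
      ≡⟨ cong (λ e → ℕ→ℚ (n C suc k) * powℚ x (suc k) * powℚ y e) (ℕ.+-∸-assoc 1 k<n) ⟨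
    shifted k                                                   ∎
    where
    absorb : ∀ a b c → a * (b * c) ≡ b * (a * c)
    absorb = solve 3 (λ a b c → a :* (b :* c) := b :* (a :* c)) refl
  lowest : ∀ a p → a * (1ℚ * 1ℚ * p) ≡ 1ℚ * 1ℚ * (a * p)
  lowest = solve 2 (λ a p → a :* (con 1ℚ :* con 1ℚ :* p) := con 1ℚ :* con 1ℚ :* (a :* p)) refl
  pascal : ∀ k → x * term k + shifted k ≡ ℕ→ℚ (suc n C suc k) * powℚ x (suc k) * powℚ y (n ∸ k)
  pascal k = begin
    x * term k + shifted k                                              ≡⟨ collect x (ℕ→ℚ (n C k)) (ℕ→ℚ (n C suc k)) (powℚ x k) (powℚ y (n ∸ k)) ⟩
    (ℕ→ℚ (n C k) + ℕ→ℚ (n C suc k)) * powℚ x (suc k) * powℚ y (n ∸ k)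
      ≡⟨ cong (λ c → c * powℚ x (suc k) * powℚ y (n ∸ k))
              (trans (sym (ℕ→ℚ-+ (n C k) (n C suc k))) (cong ℕ→ℚ (nCk+nC[k+1]≡[n+1]C[k+1] n k))) ⟩
    ℕ→ℚ (suc n C suc k) * powℚ x (suc k) * powℚ y (n ∸ k)              ∎
    where
    collect : ∀ a c d p q → a * (c * p * q) + d * (a * p) * q ≡ (c + d) * (a * p) * q
    collect = solve 5 (λ a c d p q → a :* (c :* p :* q) :+ d :* (a :* p) :* q := (c :+ d) :* (a :* p) :* q) refl

nCk*[k!*[n∸k]!]≡n! : ∀ {n k} → k ≤ n → (n C k) ℕ.* (k ℕ.! ℕ.* (n ∸ k) ℕ.!) ≡ n ℕ.!
nCk*[k!*[n∸k]!]≡n! {n} {k} k≤n =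
  trans (cong (ℕ._* (k ℕ.! ℕ.* (n ∸ k) ℕ.!)) (nCk≡n!/k![n-k]! k≤n)) (m/n*n≡m {{k ℕ.!* (n ∸ k) !≢0}} (k![n∸k]!∣n! k≤n))

[1+n]Cn≡1+n : ∀ n → suc n C n ≡ suc n
[1+n]Cn≡1+n n = trans (nCk≡nC[n∸k] (ℕ.n≤1+n n)) (trans (cong (suc n C_) (ℕ.m+n∸n≡m 1 n)) (nC1≡n (suc n)))

-- j > l is written l + 1 + r so that no truncated subtraction occurs.
nCj*jCl≡nCl*[n∸l]C[j∸l] : ∀ n l r → suc l ℕ.+ r ≤ n →
                          (n C (suc l ℕ.+ r)) ℕ.* ((suc l ℕ.+ r) C l) ≡ (n C l) ℕ.* ((n ∸ l) C suc r)
nCj*jCl≡nCl*[n∸l]C[j∸l] n l r j≤n = ℕ.*-cancelʳ-≡ _ _ (l ℕ.! ℕ.* suc r ℕ.! ℕ.* (n ∸ j) ℕ.!) {{nonZero}} (trans choose-j-first (sym choose-l-first))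
  where
  open ≡-Reasoning
  open Data.Nat.Solver.+-*-Solver
  j : ℕ
  j = suc l ℕ.+ r
  nonZero : ℕ.NonZero (l ℕ.! ℕ.* suc r ℕ.! ℕ.* (n ∸ j) ℕ.!)
  nonZero = ℕ.m*n≢0 _ _ {{ℕ.m*n≢0 _ _ {{l ℕ.!≢0}} {{suc r ℕ.!≢0}}}} {{(n ∸ j) ℕ.!≢0}}
  j∸l≡1+r : j ∸ l ≡ suc r
  j∸l≡1+r = trans (ℕ.+-∸-assoc 1 (ℕ.m≤m+n l r)) (cong suc (ℕ.m+n∸m≡n l r))
  n∸l∸[1+r]≡n∸j : (n ∸ l) ∸ suc r ≡ n ∸ j
  n∸l∸[1+r]≡n∸j = trans (ℕ.∸-+-assoc n l (suc r)) (cong (n ∸_) (ℕ.+-suc l r))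
  l≤j : l ≤ j
  l≤j = ℕ.≤-trans (ℕ.m≤m+n l r) (ℕ.n≤1+n (l ℕ.+ r))
  1+r≤n∸l : suc r ≤ n ∸ l
  1+r≤n∸l = subst (_≤ n ∸ l) j∸l≡1+r (ℕ.∸-monoˡ-≤ l j≤n)
  choose-j-first : (n C j) ℕ.* (j C l) ℕ.* (l ℕ.! ℕ.* suc r ℕ.! ℕ.* (n ∸ j) ℕ.!) ≡ n ℕ.!
  choose-j-first = begin
    (n C j) ℕ.* (j C l) ℕ.* (l ℕ.! ℕ.* suc r ℕ.! ℕ.* (n ∸ j) ℕ.!)
      ≡⟨ solve 5 (λ a b c d e → a :* b :* (c :* d :* e) := a :* (b :* (c :* d) :* e)) refl (n C j) (j C l) (l ℕ.!) (suc r ℕ.!) ((n ∸ j) ℕ.!) ⟩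
    (n C j) ℕ.* ((j C l) ℕ.* (l ℕ.! ℕ.* suc r ℕ.!) ℕ.* (n ∸ j) ℕ.!)
      ≡⟨ cong (λ w → (n C j) ℕ.* ((j C l) ℕ.* (l ℕ.! ℕ.* w ℕ.!) ℕ.* (n ∸ j) ℕ.!)) j∸l≡1+r ⟨
    (n C j) ℕ.* ((j C l) ℕ.* (l ℕ.! ℕ.* (j ∸ l) ℕ.!) ℕ.* (n ∸ j) ℕ.!)
      ≡⟨ cong (λ w → (n C j) ℕ.* (w ℕ.* (n ∸ j) ℕ.!)) (nCk*[k!*[n∸k]!]≡n! l≤j) ⟩
    (n C j) ℕ.* (j ℕ.! ℕ.* (n ∸ j) ℕ.!)
      ≡⟨ nCk*[k!*[n∸k]!]≡n! j≤n ⟩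
    n ℕ.! ∎
  choose-l-first : (n C l) ℕ.* ((n ∸ l) C suc r) ℕ.* (l ℕ.! ℕ.* suc r ℕ.! ℕ.* (n ∸ j) ℕ.!) ≡ n ℕ.!
  choose-l-first = begin
    (n C l) ℕ.* ((n ∸ l) C suc r) ℕ.* (l ℕ.! ℕ.* suc r ℕ.! ℕ.* (n ∸ j) ℕ.!)
      ≡⟨ solve 5 (λ a b c d e → a :* b :* (c :* d :* e) := a :* (c :* (b :* (d :* e)))) refl (n C l) ((n ∸ l) C suc r) (l ℕ.!) (suc r ℕ.!) ((n ∸ j) ℕ.!) ⟩
    (n C l) ℕ.* (l ℕ.! ℕ.* (((n ∸ l) C suc r) ℕ.* (suc r ℕ.! ℕ.* (n ∸ j) ℕ.!)))
      ≡⟨ cong (λ w → (n C l) ℕ.* (l ℕ.! ℕ.* (((n ∸ l) C suc r) ℕ.* (suc r ℕ.! ℕ.* w ℕ.!)))) n∸l∸[1+r]≡n∸j ⟨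
    (n C l) ℕ.* (l ℕ.! ℕ.* (((n ∸ l) C suc r) ℕ.* (suc r ℕ.! ℕ.* ((n ∸ l) ∸ suc r) ℕ.!)))
      ≡⟨ cong (λ w → (n C l) ℕ.* (l ℕ.! ℕ.* w)) (nCk*[k!*[n∸k]!]≡n! 1+r≤n∸l) ⟩
    (n C l) ℕ.* (l ℕ.! ℕ.* (n ∸ l) ℕ.!)
      ≡⟨ nCk*[k!*[n∸k]!]≡n! (ℕ.≤-trans l≤j j≤n) ⟩
    n ℕ.! ∎

-- Bernoulli numbers and polynomials

B-suc : ∀ n → B (suc n) ≡ nextBernoulli (suc n) (bernoulliUpTo n)
B-suc n = lastOr-∷ʳ 0ℚ (bernoulliUpTo n)
  where
  lastOr-∷ʳ : ∀ d xs {y} → lastOr d (xs ++ y ∷ []) ≡ y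
  lastOr-∷ʳ d [] = refl
  lastOr-∷ʳ d (x ∷ xs) = lastOr-∷ʳ x xs

bernoulliUpTo≡applyUpTo : ∀ n → bernoulliUpTo n ≡ applyUpTo B (suc n)
bernoulliUpTo≡applyUpTo zero = refl
bernoulliUpTo≡applyUpTo (suc n) =
  trans (cong₂ (λ bs b → bs ++ b ∷ []) (bernoulliUpTo≡applyUpTo n) (sym (B-suc n))) (applyUpTo-∷ʳ B (suc n))

B-recurrence : ∀ n → B (suc n) ≡ - ((+ 1 / suc (suc n)) * ∑< (suc n) (λ j → ℕ→ℚ (suc (suc n) C j) * B j))
B-recurrence n = begin
  B (suc n)                                                                    ≡⟨ B-suc n ⟩
  - ((+ 1 / suc (suc n)) * sumℚ (zipWith weigh (upTo (suc n)) (bernoulliUpTo n)))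
    ≡⟨ cong (λ bs → - ((+ 1 / suc (suc n)) * sumℚ (zipWith weigh (upTo (suc n)) bs))) (bernoulliUpTo≡applyUpTo n) ⟩
  - ((+ 1 / suc (suc n)) * sumℚ (zipWith weigh (upTo (suc n)) (applyUpTo B (suc n))))
    ≡⟨ cong (λ s → - ((+ 1 / suc (suc n)) * s)) (trans (cong sumℚ (zipWith-applyUpTo (λ j → j) B (suc n))) (sumℚ-applyUpTo (λ j → weigh j (B j)) (suc n))) ⟩
  - ((+ 1 / suc (suc n)) * ∑< (suc n) (λ j → ℕ→ℚ (suc (suc n) C j) * B j))    ∎
  where
  open ≡-Reasoning
  weigh : ℕ → ℚ → ℚ
  weigh j b = (+ (suc (suc n) C j) / 1) * b
  zipWith-applyUpTo : ∀ f g n → zipWith weigh (applyUpTo f n) (applyUpTo g n) ≡ applyUpTo (λ j → weigh (f j) (g j)) n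
  zipWith-applyUpTo f g zero = refl
  zipWith-applyUpTo f g (suc n) = cong (weigh (f 0) (g 0) ∷_) (zipWith-applyUpTo (f ∘ suc) (g ∘ suc) n)

bernoulliSum : ℕ → ℚ
bernoulliSum n = ∑< n (λ j → ℕ→ℚ (n C j) * B j)

bernoulliSum-[2+n]≡0 : ∀ n → bernoulliSum (suc (suc n)) ≡ 0ℚ
bernoulliSum-[2+n]≡0 n = begin
  ∑< (suc (suc n)) f                                  ≡⟨ ∑<-snoc (suc n) f ⟩
  ∑< (suc n) f + ℕ→ℚ (suc (suc n) C suc n) * B (suc n) ≡⟨ cong₂ (λ c b → ∑< (suc n) f + ℕ→ℚ c * b) ([1+n]Cn≡1+n (suc n)) (B-recurrence n) ⟩
  ∑< (suc n) f + ℕ→ℚ (suc (suc n)) * - (u * ∑< (suc n) f) ≡⟨ cancel (∑< (suc n) f) (ℕ→ℚ (suc (suc n))) u ⟩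
  ∑< (suc n) f - (u * ℕ→ℚ (suc (suc n))) * ∑< (suc n) f ≡⟨ cong (λ c → ∑< (suc n) f - c * ∑< (suc n) f) ([x/d]*d≡x 1 (suc (suc n))) ⟩
  ∑< (suc n) f - 1ℚ * ∑< (suc n) f                    ≡⟨ self-cancel (∑< (suc n) f) ⟩
  0ℚ                                                  ∎
  where
  open ≡-Reasoning
  open +-*-Solver
  f : ℕ → ℚ
  f j = ℕ→ℚ (suc (suc n) C j) * B j
  u : ℚ
  u = + 1 / suc (suc n)
  cancel : ∀ s c u → s + c * - (u * s) ≡ s - (u * c) * s
  cancel = solve 3 (λ s c u → s :+ c :* (:- (u :* s)) := s :- (u :* c) :* s) refl
  self-cancel : ∀ s → s - 1ℚ * s ≡ 0ℚ
  self-cancel = solve 1 (λ s → s :- con 1ℚ :* s := con 0ℚ) refl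

bernoulliSum-reverse : ∀ n → ∑< n (λ r → ℕ→ℚ (n C suc r) * B (n ∸ suc r)) ≡ bernoulliSum n
bernoulliSum-reverse n = trans (∑<-reverse n _) (∑<-cong-< n reflect)
  where
  reflect : ∀ r → r < n → ℕ→ℚ (n C suc (n ∸ suc r)) * B (n ∸ suc (n ∸ suc r)) ≡ ℕ→ℚ (n C r) * B r
  reflect r r<n = cong₂ (λ c b → ℕ→ℚ c * B b)
    (trans (cong (n C_) 1+[n∸[1+r]]≡n∸r) (sym (nCk≡nC[n∸k] (ℕ.<⇒≤ r<n))))
    (trans (cong (n ∸_) 1+[n∸[1+r]]≡n∸r) (ℕ.m∸[m∸n]≡n (ℕ.<⇒≤ r<n)))
    where
    1+[n∸[1+r]]≡n∸r : suc (n ∸ suc r) ≡ n ∸ r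
    1+[n∸[1+r]]≡n∸r = sym (ℕ.+-∸-assoc 1 r<n)

[x+1]^[1+t] : ∀ t x → powℚ (x + 1ℚ) (suc t) ≡ ∑< (suc t) (λ l → ℕ→ℚ (suc t C l) * powℚ x l) + powℚ x (suc t)
[x+1]^[1+t] t x = begin
  powℚ (x + 1ℚ) (suc t)                                              ≡⟨ binomial (suc t) x 1ℚ ⟩
  ∑< (suc (suc t)) (λ l → term l * powℚ 1ℚ (suc t ∸ l))
    ≡⟨ ∑<-cong (suc (suc t)) (λ l → trans (cong (term l *_) (powℚ-oneˡ (suc t ∸ l))) (*-identityʳ (term l))) ⟩
  ∑< (suc (suc t)) term                                              ≡⟨ ∑<-snoc (suc t) term ⟩
  ∑< (suc t) term + ℕ→ℚ (suc t C suc t) * powℚ x (suc t)              ≡⟨ cong (λ c → ∑< (suc t) term + ℕ→ℚ c * powℚ x (suc t)) (nCn≡1 (suc t)) ⟩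
  ∑< (suc t) term + 1ℚ * powℚ x (suc t)                               ≡⟨ cong (_+_ (∑< (suc t) term)) (*-identityˡ _) ⟩
  ∑< (suc t) term + powℚ x (suc t)                                    ∎
  where
  open ≡-Reasoning
  term : ℕ → ℚ
  term l = ℕ→ℚ (suc t C l) * powℚ x l

∑-binomial-bernoulliSum : ∀ κ x →
  ∑< (suc (suc κ)) (λ l → ℕ→ℚ (suc κ C l) * powℚ x l * bernoulliSum (suc κ ∸ l)) ≡ ℕ→ℚ (suc κ) * powℚ x κ
∑-binomial-bernoulliSum κ x = begin
  ∑< (suc n) h                 ≡⟨ ∑<-snoc n h ⟩
  ∑< n h + h n                 ≡⟨ cong (_+ h n) (∑<-snoc κ h) ⟩
  (∑< κ h + h κ) + h n         ≡⟨ cong₂ (λ a b → (a + h κ) + b) (trans (∑<-cong-< κ vanishing) (∑<-zero κ)) top ⟩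
  (0ℚ + h κ) + 0ℚ              ≡⟨ trans (+-identityʳ _) (+-identityˡ _) ⟩
  h κ                          ≡⟨ cong₂ (λ c m → ℕ→ℚ c * powℚ x κ * bernoulliSum m) ([1+n]Cn≡1+n κ) (ℕ.m+n∸n≡m 1 κ) ⟩
  ℕ→ℚ n * powℚ x κ * 1ℚ        ≡⟨ *-identityʳ _ ⟩
  ℕ→ℚ n * powℚ x κ             ∎
  where
  open ≡-Reasoning
  n : ℕ
  n = suc κ
  h : ℕ → ℚ
  h l = ℕ→ℚ (n C l) * powℚ x l * bernoulliSum (n ∸ l)
  top : h n ≡ 0ℚ
  top = trans (cong (λ m → ℕ→ℚ (n C n) * powℚ x n * bernoulliSum m) (ℕ.n∸n≡0 n)) (*-zeroʳ (ℕ→ℚ (n C n) * powℚ x n))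
  vanishing : ∀ l → l < κ → h l ≡ 0ℚ
  vanishing l l<κ = begin
    h l                                                       ≡⟨ cong (λ m → ℕ→ℚ (n C l) * powℚ x l * bernoulliSum m) n∸l≡2+[κ∸[1+l]] ⟩
    ℕ→ℚ (n C l) * powℚ x l * bernoulliSum (suc (suc (κ ∸ suc l)))  ≡⟨ cong (_*_ (ℕ→ℚ (n C l) * powℚ x l)) (bernoulliSum-[2+n]≡0 (κ ∸ suc l)) ⟩
    ℕ→ℚ (n C l) * powℚ x l * 0ℚ                               ≡⟨ *-zeroʳ (ℕ→ℚ (n C l) * powℚ x l) ⟩
    0ℚ                                                        ∎
    where
    n∸l≡2+[κ∸[1+l]] : n ∸ l ≡ suc (suc (κ ∸ suc l))
    n∸l≡2+[κ∸[1+l]] = trans (ℕ.+-∸-assoc 1 (ℕ.<⇒≤ l<κ)) (cong suc (ℕ.+-∸-assoc 1 l<κ))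

-- B_{κ+1}(x) − B_{κ+1}: the Bernoulli polynomial of degree κ + 1 without its constant term.
bernoulliPoly⁺ : ℕ → ℚ → ℚ
bernoulliPoly⁺ κ x = ∑< (suc κ) (λ t → ℕ→ℚ (suc κ C suc t) * B (κ ∸ t) * powℚ x (suc t))

bernoulliPoly⁺-regroup : ∀ κ x →
  ∑< (suc κ) (λ t → ℕ→ℚ (suc κ C suc t) * B (κ ∸ t) * ∑< (suc t) (λ l → ℕ→ℚ (suc t C l) * powℚ x l)) ≡
  ∑< (suc (suc κ)) (λ l → ℕ→ℚ (suc κ C l) * powℚ x l * bernoulliSum (suc κ ∸ l))
bernoulliPoly⁺-regroup κ x = begin
  ∑< n (λ t → K t * ∑< (suc t) (λ l → ℕ→ℚ (suc t C l) * powℚ x l))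
    ≡⟨ ∑<-cong n (λ t → *-∑< (suc t) (K t) (λ l → ℕ→ℚ (suc t C l) * powℚ x l)) ⟩
  ∑< n (λ t → ∑< (suc t) (g (suc t)))                               ≡⟨ +-identityˡ _ ⟨
  ∑< (suc n) (λ j → ∑< j (g j))                                     ≡⟨ ∑<-triangle (suc n) g ⟩
  ∑< (suc n) (λ l → ∑< (n ∸ l) (λ r → g (suc l ℕ.+ r) l))           ≡⟨ ∑<-cong-< (suc n) column ⟩
  ∑< (suc n) (λ l → ℕ→ℚ (n C l) * powℚ x l * bernoulliSum (n ∸ l))  ∎
  where
  open ≡-Reasoning
  open +-*-Solver
  n : ℕ
  n = suc κ
  K : ℕ → ℚ
  K t = ℕ→ℚ (n C suc t) * B (κ ∸ t)
  g : ℕ → ℕ → ℚ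
  g j l = ℕ→ℚ (n C j) * B (n ∸ j) * (ℕ→ℚ (j C l) * powℚ x l)
  column : ∀ l → l < suc n → ∑< (n ∸ l) (λ r → g (suc l ℕ.+ r) l) ≡ ℕ→ℚ (n C l) * powℚ x l * bernoulliSum (n ∸ l)
  column l l≤n = begin
    ∑< (n ∸ l) (λ r → g (suc l ℕ.+ r) l)                                       ≡⟨ ∑<-cong-< (n ∸ l) factor ⟩
    ∑< (n ∸ l) (λ r → ℕ→ℚ (n C l) * powℚ x l * (ℕ→ℚ ((n ∸ l) C suc r) * B ((n ∸ l) ∸ suc r)))
      ≡⟨ *-∑< (n ∸ l) (ℕ→ℚ (n C l) * powℚ x l) _ ⟨
    ℕ→ℚ (n C l) * powℚ x l * ∑< (n ∸ l) (λ r → ℕ→ℚ ((n ∸ l) C suc r) * B ((n ∸ l) ∸ suc r))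
      ≡⟨ cong (_*_ (ℕ→ℚ (n C l) * powℚ x l)) (bernoulliSum-reverse (n ∸ l)) ⟩
    ℕ→ℚ (n C l) * powℚ x l * bernoulliSum (n ∸ l)                               ∎
    where
    factor : ∀ r → r < n ∸ l → g (suc l ℕ.+ r) l ≡ ℕ→ℚ (n C l) * powℚ x l * (ℕ→ℚ ((n ∸ l) C suc r) * B ((n ∸ l) ∸ suc r))
    factor r r<n∸l = begin
      ℕ→ℚ (n C j) * B (n ∸ j) * (ℕ→ℚ (j C l) * powℚ x l)
        ≡⟨ solve 4 (λ a b c d → a :* b :* (c :* d) := (a :* c) :* d :* b) refl (ℕ→ℚ (n C j)) (B (n ∸ j)) (ℕ→ℚ (j C l)) (powℚ x l) ⟩
      (ℕ→ℚ (n C j) * ℕ→ℚ (j C l)) * powℚ x l * B (n ∸ j)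
        ≡⟨ cong₂ (λ c b → c * powℚ x l * B b)
                 (trans (sym (ℕ→ℚ-* (n C j) (j C l))) (trans (cong ℕ→ℚ (nCj*jCl≡nCl*[n∸l]C[j∸l] n l r j≤n)) (ℕ→ℚ-* (n C l) ((n ∸ l) C suc r))))
                 n∸j≡n∸l∸[1+r] ⟩
      (ℕ→ℚ (n C l) * ℕ→ℚ ((n ∸ l) C suc r)) * powℚ x l * B ((n ∸ l) ∸ suc r)
        ≡⟨ solve 4 (λ a b c d → (a :* b) :* c :* d := (a :* c) :* (b :* d)) refl
                   (ℕ→ℚ (n C l)) (ℕ→ℚ ((n ∸ l) C suc r)) (powℚ x l) (B ((n ∸ l) ∸ suc r)) ⟩
      ℕ→ℚ (n C l) * powℚ x l * (ℕ→ℚ ((n ∸ l) C suc r) * B ((n ∸ l) ∸ suc r)) ∎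
      where
      j : ℕ
      j = suc l ℕ.+ r
      j≤n : j ≤ n
      j≤n = subst (_≤ n) (ℕ.+-suc l r) (subst (l ℕ.+ suc r ≤_) (ℕ.m+[n∸m]≡n (ℕ.≤-pred l≤n)) (ℕ.+-monoʳ-≤ l r<n∸l))
      n∸j≡n∸l∸[1+r] : n ∸ j ≡ (n ∸ l) ∸ suc r
      n∸j≡n∸l∸[1+r] = sym (trans (ℕ.∸-+-assoc n l (suc r)) (cong (n ∸_) (ℕ.+-suc l r)))

bernoulliPoly⁺-difference : ∀ κ x → bernoulliPoly⁺ κ (x + 1ℚ) ≡ bernoulliPoly⁺ κ x + ℕ→ℚ (suc κ) * powℚ x κ
bernoulliPoly⁺-difference κ x = begin
  ∑< n (λ t → K t * powℚ (x + 1ℚ) (suc t))                          ≡⟨ ∑<-cong n (λ t → cong (_*_ (K t)) ([x+1]^[1+t] t x)) ⟩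
  ∑< n (λ t → K t * (lower t + powℚ x (suc t)))                    ≡⟨ ∑<-cong n (λ t → *-distribˡ-+ (K t) (lower t) (powℚ x (suc t))) ⟩
  ∑< n (λ t → K t * lower t + K t * powℚ x (suc t))                ≡⟨ ∑<-+ n (λ t → K t * lower t) (λ t → K t * powℚ x (suc t)) ⟩
  ∑< n (λ t → K t * lower t) + ∑< n (λ t → K t * powℚ x (suc t))   ≡⟨ +-comm (∑< n (λ t → K t * lower t)) _ ⟩
  bernoulliPoly⁺ κ x + ∑< n (λ t → K t * lower t)
    ≡⟨ cong (_+_ (bernoulliPoly⁺ κ x)) (trans (bernoulliPoly⁺-regroup κ x) (∑-binomial-bernoulliSum κ x)) ⟩
  bernoulliPoly⁺ κ x + ℕ→ℚ n * powℚ x κ                            ∎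
  where
  open ≡-Reasoning
  n : ℕ
  n = suc κ
  K : ℕ → ℚ
  K t = ℕ→ℚ (n C suc t) * B (κ ∸ t)
  lower : ℕ → ℚ
  lower t = ∑< (suc t) (λ l → ℕ→ℚ (suc t C l) * powℚ x l)

faulhaber : ∀ κ q → - bernoulliPoly⁺ κ (- ℕ→ℚ q) ≡ ℕ→ℚ (suc κ) * ∑< q (λ s → powℚ (- ℕ→ℚ (suc s)) κ)
faulhaber κ zero = begin
  - ∑< (suc κ) (λ t → ℕ→ℚ (suc κ C suc t) * B (κ ∸ t) * powℚ 0ℚ (suc t))  ≡⟨ cong -_ (∑<-cong (suc κ) vanish) ⟩
  - ∑< (suc κ) (λ _ → 0ℚ)                                                 ≡⟨ cong -_ (∑<-zero (suc κ)) ⟩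
  0ℚ                                                                      ≡⟨ *-zeroʳ (ℕ→ℚ (suc κ)) ⟨
  ℕ→ℚ (suc κ) * 0ℚ                                                        ∎
  where
  open ≡-Reasoning
  vanish : ∀ t → ℕ→ℚ (suc κ C suc t) * B (κ ∸ t) * powℚ 0ℚ (suc t) ≡ 0ℚ
  vanish t = trans (cong (_*_ (ℕ→ℚ (suc κ C suc t) * B (κ ∸ t))) (powℚ-zeroˡ t)) (*-zeroʳ (ℕ→ℚ (suc κ C suc t) * B (κ ∸ t)))
faulhaber κ (suc q) = begin
  - bernoulliPoly⁺ κ x                                 ≡⟨ shift (bernoulliPoly⁺ κ x) (c * powℚ x κ) ⟩
  - (bernoulliPoly⁺ κ x + c * powℚ x κ) + c * powℚ x κ ≡⟨ cong (λ v → - v + c * powℚ x κ) (bernoulliPoly⁺-difference κ x) ⟨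
  - bernoulliPoly⁺ κ (x + 1ℚ) + c * powℚ x κ           ≡⟨ cong (λ y → - bernoulliPoly⁺ κ y + c * powℚ x κ) x+1≡-q ⟩
  - bernoulliPoly⁺ κ (- ℕ→ℚ q) + c * powℚ x κ          ≡⟨ cong (_+ c * powℚ x κ) (faulhaber κ q) ⟩
  c * ∑< q f + c * powℚ x κ                            ≡⟨ *-distribˡ-+ c (∑< q f) (powℚ x κ) ⟨
  c * (∑< q f + powℚ x κ)                              ≡⟨ cong (c *_) (∑<-snoc q f) ⟨
  c * ∑< (suc q) f                                     ∎
  where
  open ≡-Reasoning
  open +-*-Solver
  c x : ℚ
  c = ℕ→ℚ (suc κ)
  x = - ℕ→ℚ (suc q)
  f : ℕ → ℚ
  f s = powℚ (- ℕ→ℚ (suc s)) κ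
  shift : ∀ b d → - b ≡ - (b + d) + d
  shift = solve 2 (λ b d → :- b := :- (b :+ d) :+ d) refl
  x+1≡-q : x + 1ℚ ≡ - ℕ→ℚ q
  x+1≡-q = trans (cong (λ y → - y + 1ℚ) (ℕ→ℚ-+ 1 q)) (solve 1 (λ y → :- (con 1ℚ :+ y) :+ con 1ℚ := :- y) refl (ℕ→ℚ q))

-- Power sums over a residue class

∑<-reflect : ∀ q (g : ℚ → ℚ) → ∑< q (λ t → g (ℕ→ℚ q - ℕ→ℚ (suc t))) ≡ ∑< q (λ s → g (ℕ→ℚ s))
∑<-reflect zero g = refl
∑<-reflect (suc q) g = begin
  g (ℕ→ℚ (suc q) - ℕ→ℚ 1) + ∑< q (λ t → g (ℕ→ℚ (suc q) - ℕ→ℚ (suc (suc t))))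
    ≡⟨ cong₂ _+_ (cong g (trans (shift 0) (+-identityʳ (ℕ→ℚ q)))) (∑<-cong q (λ t → cong g (shift (suc t)))) ⟩
  g (ℕ→ℚ q) + ∑< q (λ t → g (ℕ→ℚ q - ℕ→ℚ (suc t)))      ≡⟨ cong (_+_ (g (ℕ→ℚ q))) (∑<-reflect q g) ⟩
  g (ℕ→ℚ q) + ∑< q (λ s → g (ℕ→ℚ s))                    ≡⟨ +-comm (g (ℕ→ℚ q)) _ ⟩
  ∑< q (λ s → g (ℕ→ℚ s)) + g (ℕ→ℚ q)                    ≡⟨ ∑<-snoc q (λ s → g (ℕ→ℚ s)) ⟨
  ∑< (suc q) (λ s → g (ℕ→ℚ s))                          ∎
  where
  open ≡-Reasoning
  shift : ∀ t → ℕ→ℚ (suc q) - ℕ→ℚ (suc t) ≡ ℕ→ℚ q - ℕ→ℚ t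
  shift t = trans (cong₂ _-_ (ℕ→ℚ-+ 1 q) (ℕ→ℚ-+ 1 t))
                  (solve 2 (λ q t → (con 1ℚ :+ q) :- (con 1ℚ :+ t) := q :- t) refl (ℕ→ℚ q) (ℕ→ℚ t))
    where open +-*-Solver

powDiff-*-powℚ : ∀ a κ j .{{_ : ℕ.NonZero a}} → powDiff a κ j * powℚ (ℕ→ℚ a) j ≡ powℚ (ℕ→ℚ a) κ
powDiff-*-powℚ a@(suc _) κ j = begin
  powDiff a κ j * powℚ (ℕ→ℚ a) j   ≡⟨ cong (powDiff a κ j *_) (ℕ→ℚ-^ a j) ⟨
  powDiff a κ j * ℕ→ℚ (a ^ j)      ≡⟨ [x/d]*d≡x (a ^ κ) (a ^ j) {{ℕ.m^n≢0 a j}} ⟩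
  ℕ→ℚ (a ^ κ)                      ≡⟨ ℕ→ℚ-^ a κ ⟩
  powℚ (ℕ→ℚ a) κ                   ∎
  where open ≡-Reasoning

powℚ-neg : ∀ y t → powℚ (- y) (suc t) ≡ - (powℚ (- 1ℚ) t * powℚ y (suc t))
powℚ-neg y t = begin
  powℚ (- y) (suc t)                           ≡⟨ cong (λ z → powℚ z (suc t)) (solve 1 (λ y → :- y := (:- con 1ℚ) :* y) refl y) ⟩
  powℚ (- 1ℚ * y) (suc t)                      ≡⟨ powℚ-* (- 1ℚ) y (suc t) ⟩
  - 1ℚ * powℚ (- 1ℚ) t * powℚ y (suc t)        ≡⟨ solve 2 (λ s p → :- con 1ℚ :* s :* p := :- (s :* p)) refl (powℚ (- 1ℚ) t) (powℚ y (suc t)) ⟩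
  - (powℚ (- 1ℚ) t * powℚ y (suc t))           ∎
  where
  open ≡-Reasoning
  open +-*-Solver

coefficient : ℕ → ℕ → ℕ → ℕ → ℚ
coefficient μ a κ j =
  ℕ→ℚ (μ C κ) * ℕ→ℚ (suc κ C j) * powℚ (- 1ℚ) (j ∸ 1) * (+ 1 / suc κ) * powDiff a κ j * B (suc κ ∸ j)

-- (a q)^j a^(κ−j) = a^κ q^j, and Σ_j C(κ+1,j) (−1)^(j−1) B_{κ+1−j} q^j = − bernoulliPoly⁺ κ (− q).
coefficient-sum : ∀ μ a κ q M .{{_ : ℕ.NonZero a}} →
  ∑< (suc κ) (λ t → coefficient μ a κ (suc t) * (powℚ (ℕ→ℚ a * ℕ→ℚ q) (suc t) * powℚ M (μ ∸ κ))) ≡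
  ∑< q (λ s → ℕ→ℚ (μ C κ) * powℚ (ℕ→ℚ a * - ℕ→ℚ (suc s)) κ * powℚ M (μ ∸ κ))
coefficient-sum μ a κ q M = begin
  ∑< (suc κ) (λ t → coefficient μ a κ (suc t) * (powℚ (A * Q) (suc t) * Mp))
    ≡⟨ ∑<-cong (suc κ) regroup ⟩
  ∑< (suc κ) (λ t → - (K * u) * (ℕ→ℚ (suc κ C suc t) * B (κ ∸ t) * powℚ (- Q) (suc t)))
    ≡⟨ *-∑< (suc κ) (- (K * u)) (λ t → ℕ→ℚ (suc κ C suc t) * B (κ ∸ t) * powℚ (- Q) (suc t)) ⟨
  - (K * u) * bernoulliPoly⁺ κ (- Q)                     ≡⟨ solve 3 (λ k u b → :- (k :* u) :* b := k :* (u :* (:- b))) refl K u _ ⟩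
  K * (u * - bernoulliPoly⁺ κ (- Q))                     ≡⟨ cong (λ b → K * (u * b)) (faulhaber κ q) ⟩
  K * (u * (ℕ→ℚ (suc κ) * ∑< q f))                       ≡⟨ cong (K *_) (sym (*-assoc u _ _)) ⟩
  K * (u * ℕ→ℚ (suc κ) * ∑< q f)                         ≡⟨ cong (λ c → K * (c * ∑< q f)) ([x/d]*d≡x 1 (suc κ)) ⟩
  K * (1ℚ * ∑< q f)                                      ≡⟨ cong (K *_) (*-identityˡ _) ⟩
  K * ∑< q f                                             ≡⟨ *-∑< q K f ⟩
  ∑< q (λ s → K * f s)                                   ≡⟨ ∑<-cong q expand ⟩
  ∑< q (λ s → ℕ→ℚ (μ C κ) * powℚ (A * - ℕ→ℚ (suc s)) κ * Mp) ∎
  where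
  open ≡-Reasoning
  open +-*-Solver
  A Q Mp u K : ℚ
  A = ℕ→ℚ a
  Q = ℕ→ℚ q
  Mp = powℚ M (μ ∸ κ)
  u = + 1 / suc κ
  K = ℕ→ℚ (μ C κ) * Mp * powℚ A κ
  f : ℕ → ℚ
  f s = powℚ (- ℕ→ℚ (suc s)) κ
  regroup : ∀ t → coefficient μ a κ (suc t) * (powℚ (A * Q) (suc t) * Mp) ≡
                  - (K * u) * (ℕ→ℚ (suc κ C suc t) * B (κ ∸ t) * powℚ (- Q) (suc t))
  regroup t = begin
    c₁ * c₂ * σ * u * pd * b * (powℚ (A * Q) (suc t) * Mp)        ≡⟨ cong (λ p → c₁ * c₂ * σ * u * pd * b * (p * Mp)) (powℚ-* A Q (suc t)) ⟩
    c₁ * c₂ * σ * u * pd * b * ((pa * pq) * Mp)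
      ≡⟨ solve 9 (λ c₁ c₂ σ u pd b pa pq mp → c₁ :* c₂ :* σ :* u :* pd :* b :* ((pa :* pq) :* mp) :=
                   :- (c₁ :* mp :* (pd :* pa) :* u) :* (c₂ :* b :* :- (σ :* pq))) refl c₁ c₂ σ u pd b pa pq Mp ⟩
    - (ℕ→ℚ (μ C κ) * Mp * (pd * pa) * u) * (c₂ * b * - (σ * pq))
      ≡⟨ cong₂ (λ p n → - (ℕ→ℚ (μ C κ) * Mp * p * u) * (c₂ * b * n)) (powDiff-*-powℚ a κ (suc t)) (sym (powℚ-neg Q t)) ⟩
    - (K * u) * (c₂ * b * powℚ (- Q) (suc t))                     ∎
    where
    c₁ c₂ σ pd b pa pq : ℚ
    c₁ = ℕ→ℚ (μ C κ)
    c₂ = ℕ→ℚ (suc κ C suc t)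
    σ = powℚ (- 1ℚ) t
    pd = powDiff a κ (suc t)
    b = B (κ ∸ t)
    pa = powℚ A (suc t)
    pq = powℚ Q (suc t)
  expand : ∀ s → K * f s ≡ ℕ→ℚ (μ C κ) * powℚ (A * - ℕ→ℚ (suc s)) κ * Mp
  expand s = trans (solve 4 (λ c m p n → c :* m :* p :* n := c :* (p :* n) :* m) refl (ℕ→ℚ (μ C κ)) Mp (powℚ A κ) (f s))
                   (cong (λ p → ℕ→ℚ (μ C κ) * p * Mp) (sym (powℚ-* A (- ℕ→ℚ (suc s)) κ)))

powerSum-residueClass : ∀ μ a i q m .{{_ : ℕ.NonZero a}} → m ≡ i ℕ.+ a ℕ.* q →
  ∑< (suc μ) (λ κ → ∑< (suc κ) (λ t → coefficient μ a κ (suc t) * (powℚ (ℤ→ℚ (+ m ℤ.- + i)) (suc t) * powℚ (ℕ→ℚ m) (μ ∸ κ)))) ≡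
  ∑< q (λ s → ℕ→ℚ ((i ℕ.+ a ℕ.* s) ^ μ))
powerSum-residueClass μ a i q m refl = begin
  ∑< (suc μ) (λ κ → ∑< (suc κ) (λ t → coefficient μ a κ (suc t) * (powℚ (ℤ→ℚ (+ m ℤ.- + i)) (suc t) * powℚ M (μ ∸ κ))))
    ≡⟨ ∑<-cong (suc μ) (λ κ → trans (∑<-cong (suc κ) (λ t → cong (λ z → coefficient μ a κ (suc t) * (powℚ z (suc t) * powℚ M (μ ∸ κ))) m-i≡A*Q))
                                    (coefficient-sum μ a κ q M)) ⟩
  ∑< (suc μ) (λ κ → ∑< q (λ s → ℕ→ℚ (μ C κ) * powℚ (A * - ℕ→ℚ (suc s)) κ * powℚ M (μ ∸ κ)))
    ≡⟨ ∑<-swap (suc μ) q (λ κ s → ℕ→ℚ (μ C κ) * powℚ (A * - ℕ→ℚ (suc s)) κ * powℚ M (μ ∸ κ)) ⟩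
  ∑< q (λ s → ∑< (suc μ) (λ κ → ℕ→ℚ (μ C κ) * powℚ (A * - ℕ→ℚ (suc s)) κ * powℚ M (μ ∸ κ)))
    ≡⟨ ∑<-cong q (λ s → binomial μ (A * - ℕ→ℚ (suc s)) M) ⟨
  ∑< q (λ s → powℚ (A * - ℕ→ℚ (suc s) + M) μ)
    ≡⟨ ∑<-cong q (λ s → cong (λ z → powℚ z μ) (regroup s)) ⟩
  ∑< q (λ s → powℚ (I + A * (ℕ→ℚ q - ℕ→ℚ (suc s))) μ)
    ≡⟨ ∑<-reflect q (λ y → powℚ (I + A * y) μ) ⟩
  ∑< q (λ s → powℚ (I + A * ℕ→ℚ s) μ)
    ≡⟨ ∑<-cong q (λ s → trans (cong (λ z → powℚ z μ) (sym (i+a*s s))) (sym (ℕ→ℚ-^ (i ℕ.+ a ℕ.* s) μ))) ⟩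
  ∑< q (λ s → ℕ→ℚ ((i ℕ.+ a ℕ.* s) ^ μ))   ∎
  where
  open ≡-Reasoning
  A I M : ℚ
  A = ℕ→ℚ a
  I = ℕ→ℚ i
  M = ℕ→ℚ m
  i+a*s : ∀ s → ℕ→ℚ (i ℕ.+ a ℕ.* s) ≡ I + A * ℕ→ℚ s
  i+a*s s = trans (ℕ→ℚ-+ i (a ℕ.* s)) (cong (_+_ I) (ℕ→ℚ-* a s))
  m-i≡A*Q : ℤ→ℚ (+ m ℤ.- + i) ≡ A * ℕ→ℚ q
  m-i≡A*Q = trans (ℤ→ℚ-[i+n]-i i (a ℕ.* q)) (ℕ→ℚ-* a q)
  regroup : ∀ s → A * - ℕ→ℚ (suc s) + M ≡ I + A * (ℕ→ℚ q - ℕ→ℚ (suc s))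
  regroup s = trans (cong (_+_ (A * - ℕ→ℚ (suc s))) (i+a*s q))
                    (solve 4 (λ a t i q → a :* :- t :+ (i :+ a :* q) := i :+ a :* (q :- t)) refl A (ℕ→ℚ (suc s)) I (ℕ→ℚ q))
    where open +-*-Solver

powerSum-NR : ∀ {k} (a : Fin (suc k) → ℕ) (pos : ∀ i → 0 < a i) →
  (m : ℕ → ℕ) → ((i : ℕ) → 1 ≤ i → i < a zero → IsLeastRep a (a zero) i (m i)) →
  (L : List ℕ) → Unique L → ((n : ℕ) → (n ∈ L) ⇔ InNR a n) → (μ : ℕ) →
  ℕ→ℚ (sumℕ (map (λ n → n ^ μ) L)) ≡
    Σ[ 0 to μ ] (λ κ → Σ[ 1 to suc κ ] (λ j →
      coefficient μ (a zero) κ j * Σ[ 1 to a zero ∸ 1 ] (λ i → powℚ (ℤ→ℚ (+ m i ℤ.- + i)) j * powℚ (ℕ→ℚ (m i)) (μ ∸ κ))))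
powerSum-NR a pos m m-least L L-unique L≡NR μ = begin
  ℕ→ℚ (sum (map (_^ μ) L))
    ≡⟨ cong ℕ→ℚ (sum-NR a pos m m-least (_^ μ) L L-unique L≡NR) ⟩
  ℕ→ℚ (sum (map (λ i → sum (map (_^ μ) (gapsOf a pos m m-least i))) (applyUpTo suc (N ∸ 1))))
    ≡⟨ ℕ→ℚ-sum-map-applyUpTo _ suc (N ∸ 1) ⟩
  ∑< (N ∸ 1) (λ u → ℕ→ℚ (sum (map (_^ μ) (gapsOf a pos m m-least (suc u)))))
    ≡⟨ ∑<-cong (N ∸ 1) (λ u → ℕ→ℚ-sum-map-applyUpTo (_^ μ) _ (q (suc u))) ⟩
  ∑< (N ∸ 1) (λ u → ∑< (q (suc u)) (λ s → ℕ→ℚ ((suc u ℕ.+ N ℕ.* s) ^ μ)))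
    ≡⟨ ∑<-cong-< (N ∸ 1) residueClass ⟨
  ∑< (N ∸ 1) (λ u → ∑< (suc μ) (λ κ → ∑< (suc κ) (λ t → coefficient μ N κ (suc t) * h κ (suc t) (suc u))))
    ≡⟨ ∑<-interchange₃ (suc μ) suc (N ∸ 1) (λ κ t → coefficient μ N κ (suc t)) (λ κ t u → h κ (suc t) (suc u)) ⟨
  ∑< (suc μ) (λ κ → ∑< (suc κ) (λ t → coefficient μ N κ (suc t) * ∑< (N ∸ 1) (λ u → h κ (suc t) (suc u))))
    ≡⟨ ∑<-cong (suc μ) (λ κ → ∑<-cong (suc κ) (λ t → cong (coefficient μ N κ (suc t) *_) (Σ[to]≡∑< 1 (N ∸ 1) (h κ (suc t))))) ⟨
  ∑< (suc μ) (λ κ → ∑< (suc κ) (λ t → coefficient μ N κ (suc t) * Σ[ 1 to N ∸ 1 ] (h κ (suc t))))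
    ≡⟨ ∑<-cong (suc μ) (λ κ → Σ[to]≡∑< 1 (suc κ) (λ j → coefficient μ N κ j * Σ[ 1 to N ∸ 1 ] (h κ j))) ⟨
  ∑< (suc μ) (λ κ → Σ[ 1 to suc κ ] (λ j → coefficient μ N κ j * Σ[ 1 to N ∸ 1 ] (h κ j)))
    ≡⟨ Σ[to]≡∑< 0 μ (λ κ → Σ[ 1 to suc κ ] (λ j → coefficient μ N κ j * Σ[ 1 to N ∸ 1 ] (h κ j))) ⟨
  Σ[ 0 to μ ] (λ κ → Σ[ 1 to suc κ ] (λ j → coefficient μ N κ j * Σ[ 1 to N ∸ 1 ] (h κ j))) ∎
  where
  open ≡-Reasoning
  N : ℕ
  N = a zero
  instance
    N≢0 : ℕ.NonZero N
    N≢0 = ℕ.>-nonZero (pos zero)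
  q : ℕ → ℕ
  q = quotient a pos m m-least
  h : ℕ → ℕ → ℕ → ℚ
  h κ j i = powℚ (ℤ→ℚ (+ m i ℤ.- + i)) j * powℚ (ℕ→ℚ (m i)) (μ ∸ κ)
  residueClass : ∀ u → u < N ∸ 1 →
    ∑< (suc μ) (λ κ → ∑< (suc κ) (λ t → coefficient μ N κ (suc t) * h κ (suc t) (suc u))) ≡
    ∑< (q (suc u)) (λ s → ℕ→ℚ ((suc u ℕ.+ N ℕ.* s) ^ μ))
  residueClass u u<N∸1 = powerSum-residueClass μ N (suc u) (q (suc u)) (m (suc u))
    (leastRep≡i+N*quotient a pos m m-least (suc u) (s≤s z≤n) (ℕ.pred-cancel-< u<N∸1))

theorem5 : (k : ℕ) → 1 ≤ k → (a : Fin (suc k) → ℕ) → Injective _≡_ _≡_ a →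
    (∀ i → 0 < a i) → gcdAll a ≡ 1 →
    (Σ (List ℕ) (λ L → Unique L × ((n : ℕ) → (n ∈ L) ⇔ InNR a n))) ×
    (Σ (ℕ → ℕ) (λ m → (i : ℕ) → 1 ≤ i → i < a zero → IsLeastRep a (a zero) i (m i))) ×
    ((m : ℕ → ℕ) → ((i : ℕ) → 1 ≤ i → i < a zero → IsLeastRep a (a zero) i (m i)) →
     (L : List ℕ) → Unique L → ((n : ℕ) → (n ∈ L) ⇔ InNR a n) →
     (μ : ℕ) → 1 ≤ μ →
     ℕ→ℚ (sumℕ (map (λ n → n ^ μ) L)) ≡
       Σ[ 0 to μ ] (λ κ → Σ[ 1 to suc κ ] (λ j →
         ℕ→ℚ (μ C κ) * ℕ→ℚ (suc κ C j) * powℚ (- 1ℚ) (j ∸ 1) * (+ 1 / suc κ) *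
         powDiff (a zero) κ j * B (suc κ ∸ j) *
         Σ[ 1 to a zero ∸ 1 ] (λ i →
           powℚ (ℤ→ℚ (+ m i ℤ.- + i)) j * powℚ (ℕ→ℚ (m i)) (μ ∸ κ)))))
theorem5 k _ a _ pos gcd≡1 =
  (gaps a pos m m-least , gaps-unique a pos m m-least , λ n → mk⇔ (gaps⊆NR a pos m m-least) (NR⊆gaps a pos m m-least)) ,
  (m , m-least) ,
  λ m′ m′-least L L-unique L≡NR μ _ → powerSum-NR a pos m′ m′-least L L-unique L≡NR μ
  where
  m : ℕ → ℕ
  m = proj₁ (leastReps a pos gcd≡1)
  m-least : ∀ i → 1 ≤ i → i < a zero → IsLeastRep a (a zero) i (m i)
  m-least = proj₂ (leastReps a pos gcd≡1)
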